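{- Let $m\in\mathbb{Z}_{>0}$. Then $$\left\{\mu\in\Lambda(m):\mu_1+\mu_2=m+2,\ \binom{m}{\mu_1-1}\not\equiv0\pmod p\right\}=\{\mu\in\Lambda(m):\mu_1+\mu_2=m+2,\ \Delta(\mu)=0\}.$$
   Context: Let $p$ be a prime, $\mathbb{F}=\mathbb{F}_p$, $S=\mathbb{F}[x,y]$, $\mathrm{Der}_S=S\partial_x\oplus S\partial_y$. Let $\mathcal{A}=\{H_1,H_2,H_3\}$ with $H_1=\ker x$, $H_2=\ker y$, $H_3=\ker(x+y)$, $\alpha_1=x,\alpha_2=y,\alpha_3=x+y$. For $\mu\in\mathbb{Z}_{\ge0}^3$, $D(\mathcal{A},\mu)=\{\theta\in\mathrm{Der}_S:\theta(\alpha_i)\in\alpha_i^{\mu_i}S,\ i=1,2,3\}$; it is free of rank 2 with a homogeneous basis whose degrees (exponents) are unique up to order; $\Delta(\mu)$ is the absolute difference of the exponents. $\Lambda(m)=\{\mu\in\mathbb{Z}_{\ge0}^3:\mu_3=m\}$; binomial coefficients $\binom{a}{b}$ are $0$ when $b<0$ or $b>a$. -}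

module Defs where

open import Data.Nat using (ℕ; zero; suc; _+_; _*_; _∸_; _≤_)
open import Data.Nat.Combinatorics using (_C_)
import Data.Product
open Data.Product using (Σ; _×_; _,_)
open import Relation.Binary.PropositionalEquality using (_≡_)
open import Relation.Nullary using (¬_)

ModEq : ℕ → ℕ → ℕ → Set
ModEq p a b = Σ ℕ λ k → Σ ℕ λ l → a + k * p ≡ b + l * p

-- Raw coefficient functions: f i j is the coefficient of x^i y^j (an integer
-- representative of an element of F_p).
Coeffs : Set
Coeffs = ℕ → ℕ → ℕ

-- An element of S = F_p[x,y]: coefficient function with finite support mod p.
record Poly (p : ℕ) : Set where
  constructor poly
  field
    coeff  : Coeffs
    bound  : ℕ
    finite : ∀ i j → bound ≤ i + j → ModEq p (coeff i j) 0
open Poly public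

_≈[_]_ : ∀ {p} → Poly p → ℕ → Poly p → Set
f ≈[ p ] g = ∀ i j → ModEq p (coeff f i j) (coeff g i j)

sumTo : ℕ → (ℕ → ℕ) → ℕ
sumTo zero    h = h 0
sumTo (suc n) h = sumTo n h + h (suc n)

addC : Coeffs → Coeffs → Coeffs
addC f g i j = f i j + g i j

mulC : Coeffs → Coeffs → Coeffs
mulC f g i j = sumTo i λ a → sumTo j λ b → f a b * g (i ∸ a) (j ∸ b)

-- Homogeneous of degree d (zero is homogeneous of every degree)
HomogC : ℕ → ℕ → Coeffs → Set
HomogC p d f = ∀ i j → ¬ (i + j ≡ d) → ModEq p (f i j) 0

xC yC xyC : Coeffs
xC 1 0 = 1
xC _ _ = 0
yC 0 1 = 1
yC _ _ = 0
xyC i j = addC xC yC i j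

oneC : Coeffs
oneC 0 0 = 1
oneC _ _ = 0

powC : Coeffs → ℕ → Coeffs
powC f zero    = oneC
powC f (suc k) = mulC f (powC f k)

DivBy : (p : ℕ) → Coeffs → ℕ → Poly p → Set
DivBy p α k f = Σ (Poly p) λ h → ∀ i j → ModEq p (coeff f i j) (mulC (powC α k) (coeff h) i j)

-- A derivation θ = f ∂x + g ∂y ∈ Der_S, stored as (θ(x), θ(y)) = (f, g)
Der : ℕ → Set
Der p = Poly p × Poly p

DerEq : ∀ {p} → Der p → Der p → Set
DerEq {p} (f , g) (f' , g') = (f ≈[ p ] f') × (g ≈[ p ] g')

-- θ ∈ D(A, μ) for A = {x, y, x+y}, μ = (μ₁, μ₂, μ₃);  θ(x+y) = f + g
InD : (p μ₁ μ₂ μ₃ : ℕ) → Der p → Set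
InD p μ₁ μ₂ μ₃ (f , g) =
  DivBy p xC μ₁ f × DivBy p yC μ₂ g ×
  (Σ (Poly p) λ h → ∀ i j →
     ModEq p (addC (coeff f) (coeff g) i j) (mulC (powC xyC μ₃) (coeff h) i j))

combC : ∀ {p} → Poly p → Poly p → Der p → Der p → Coeffs × Coeffs
combC a b (f₁ , g₁) (f₂ , g₂) =
  addC (mulC (coeff a) (coeff f₁)) (mulC (coeff b) (coeff f₂)) ,
  addC (mulC (coeff a) (coeff g₁)) (mulC (coeff b) (coeff g₂))

IsBasis : (p μ₁ μ₂ μ₃ : ℕ) → Der p → Der p → Set
IsBasis p μ₁ μ₂ μ₃ θ₁ θ₂ =
  InD p μ₁ μ₂ μ₃ θ₁ × InD p μ₁ μ₂ μ₃ θ₂ ×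
  (∀ (θ : Der p) → InD p μ₁ μ₂ μ₃ θ →
     Σ (Poly p) λ a → Σ (Poly p) λ b →
       let (u , v) = combC a b θ₁ θ₂ in
       (∀ i j → ModEq p (coeff (Data.Product.proj₁ θ) i j) (u i j)) ×
       (∀ i j → ModEq p (coeff (Data.Product.proj₂ θ) i j) (v i j))) ×
  (∀ (a b : Poly p) →
     let (u , v) = combC a b θ₁ θ₂ in
     (∀ i j → ModEq p (u i j) 0) → (∀ i j → ModEq p (v i j) 0) →
     (∀ i j → ModEq p (coeff a i j) 0) × (∀ i j → ModEq p (coeff b i j) 0))

HomogDer : ∀ {p} → ℕ → Der p → Set
HomogDer {p} d (f , g) = HomogC p d (coeff f) × HomogC p d (coeff g)

-- Δ(μ) = 0 : D(A, μ) has a homogeneous basis whose two exponents coincide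
-- (exponents are unique, so this is exactly Δ(μ) = 0).
DeltaZero : (p μ₁ μ₂ μ₃ : ℕ) → Set
DeltaZero p μ₁ μ₂ μ₃ =
  Σ ℕ λ d → Σ (Der p) λ θ₁ → Σ (Der p) λ θ₂ →
    HomogDer d θ₁ × HomogDer d θ₂ × IsBasis p μ₁ μ₂ μ₃ θ₁ θ₂

-- binom(m, k-1) with the convention binom(a, b) = 0 for b < 0 (and for b > a,
-- which is built into _C_)
binomPred : ℕ → ℕ → ℕ
binomPred m zero    = 0
binomPred m (suc k) = m C k

{-# OPTIONS --safe #-}
module Submission where

-- Write P = (x + y)^m and let split w be the derivation sending x to the part of w of x-degree ≥ μ₁
-- and y to the rest, so that it sends x + y to w.
--
-- If p ∤ c = binom(m, μ₁ − 1), write μ₁ = k + 1, μ₂ = l + 1 (so k + l = m). The derivations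
-- θ₁ = split (x P) and θ₂ = split (y P) lie in D(A, μ), have degree m + 1, and satisfy
-- y θ₁ − x θ₂ = c x^(k+1) y^(l+1) (∂x − ∂y). If θ ∈ D(A, μ) and θ(x + y) = P (h₀ + x H₁ + y H₂), then
-- h₀ = 0 and θ − H₁ θ₁ − H₂ θ₂ = (S, −S) with x^(k+1) y^(l+1) ∣ S; as c is a unit, the relation
-- writes (S, −S) as a combination of θ₁ and θ₂. The same relation shows that θ₁, θ₂ are
-- independent, so Δ(μ) = 0.
--
-- Conversely, in degrees ≤ m every element of D(A, μ) is a scalar multiple of ζ = split P, so no
-- basis has two equal exponents ≤ m. If p ∣ c then ζ ∈ D(A, μ), and ζ has degree m, so it is not
-- generated by two elements of a larger degree.

open import Defs
open import Data.Nat
  using (ℕ; zero; suc; pred; _+_; _*_; _∸_; _≤_; _<_; z≤n; s≤s; _≤?_; _≟_; NonZero; nonTrivial⇒n>1)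
open import Data.Nat.Properties
open import Data.Nat.Combinatorics using (_C_; nCn≡1; nCk+nC[k+1]≡[n+1]C[k+1]; k>n⇒nCk≡0)
open import Data.Nat.Divisibility using (_∣_; divides; _∣0)
open import Data.Nat.Primality using (Prime; prime⇒nonZero; prime⇒nonTrivial; prime⇒irreducible)
open import Data.Nat.Coprimality using (Coprime; coprime-Bézout)
open import Data.Nat.GCD using (module Bézout)
open import Data.Product using (Σ; _×_; _,_; proj₁; proj₂)
open import Data.Sum using (_⊎_; inj₁; inj₂)
open import Data.Empty using (⊥; ⊥-elim)
open import Function using (_∘_)
open import Relation.Binary.PropositionalEquality
open import Relation.Nullary using (¬_; yes; no; contradiction)
open import Relation.Binary.Definitions using (tri<; tri≈; tri>)
open import Data.Nat.Tactic.RingSolver using (solve-∀)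
open import Algebra.Properties.CommutativeSemigroup +-commutativeSemigroup
  using () renaming (interchange to +-interchange; x∙yz≈y∙xz to +-exchangeˡ; xy∙z≈xz∙y to +-exchangeʳ)
open import Data.Nat.DivMod
  using (_%_; _/_; %-distribˡ-+; %-distribˡ-*; m*n%n≡0; [m+kn]%n≡m%n; m≡m%n+[m/n]*n; m<n⇒m%n≡m)
open import Relation.Binary.Bundles using (Setoid)
import Relation.Binary.Reasoning.Setoid as SetoidReasoning

sumTo-cong : ∀ n {h h′ : ℕ → ℕ} → (∀ a → a ≤ n → h a ≡ h′ a) → sumTo n h ≡ sumTo n h′
sumTo-cong zero    h≗h′ = h≗h′ 0 z≤n
sumTo-cong (suc n) h≗h′ =
  cong₂ _+_ (sumTo-cong n (λ a a≤n → h≗h′ a (m≤n⇒m≤1+n a≤n))) (h≗h′ (suc n) ≤-refl)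

sumTo-zero : ∀ n {h : ℕ → ℕ} → (∀ a → a ≤ n → h a ≡ 0) → sumTo n h ≡ 0
sumTo-zero zero    h≡0 = h≡0 0 z≤n
sumTo-zero (suc n) h≡0 =
  cong₂ _+_ (sumTo-zero n (λ a a≤n → h≡0 a (m≤n⇒m≤1+n a≤n))) (h≡0 (suc n) ≤-refl)

sumTo-unfoldˡ : ∀ n h → sumTo (suc n) h ≡ h 0 + sumTo n (h ∘ suc)
sumTo-unfoldˡ zero    h = refl
sumTo-unfoldˡ (suc n) h = begin
  sumTo (suc n) h + h (suc (suc n))               ≡⟨ cong (_+ h (suc (suc n))) (sumTo-unfoldˡ n h) ⟩
  h 0 + sumTo n (h ∘ suc) + h (suc (suc n))       ≡⟨ +-assoc (h 0) _ _ ⟩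
  h 0 + sumTo (suc n) (h ∘ suc)                   ∎
  where open ≡-Reasoning

sumTo-onlyLast : ∀ n {h : ℕ → ℕ} → (∀ a → a < n → h a ≡ 0) → sumTo n h ≡ h n
sumTo-onlyLast zero    _   = refl
sumTo-onlyLast (suc n) {h} h≡0 = cong (_+ h (suc n)) (sumTo-zero n (λ a a≤n → h≡0 a (s≤s a≤n)))

sumTo-onlyFirst : ∀ n {h : ℕ → ℕ} → (∀ a → h (suc a) ≡ 0) → sumTo n h ≡ h 0
sumTo-onlyFirst zero    _   = refl
sumTo-onlyFirst (suc n) {h} h≡0 = begin
  sumTo (suc n) h          ≡⟨ sumTo-unfoldˡ n h ⟩
  h 0 + sumTo n (h ∘ suc)  ≡⟨ cong (h 0 +_) (sumTo-zero n (λ a _ → h≡0 a)) ⟩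
  h 0 + 0                  ≡⟨ +-identityʳ (h 0) ⟩
  h 0                      ∎
  where open ≡-Reasoning

sumTo-+ : ∀ n h h′ → sumTo n (λ a → h a + h′ a) ≡ sumTo n h + sumTo n h′
sumTo-+ zero    h h′ = refl
sumTo-+ (suc n) h h′ = begin
  sumTo n (λ a → h a + h′ a) + (h (suc n) + h′ (suc n))
    ≡⟨ cong (_+ (h (suc n) + h′ (suc n))) (sumTo-+ n h h′) ⟩
  (sumTo n h + sumTo n h′) + (h (suc n) + h′ (suc n))    ≡⟨ +-interchange (sumTo n h) (sumTo n h′) _ _ ⟩
  (sumTo n h + h (suc n)) + (sumTo n h′ + h′ (suc n))    ∎
  where open ≡-Reasoning

*-distribˡ-sumTo : ∀ n c h → sumTo n (λ a → c * h a) ≡ c * sumTo n h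
*-distribˡ-sumTo zero    c h = refl
*-distribˡ-sumTo (suc n) c h =
  trans (cong (_+ c * h (suc n)) (*-distribˡ-sumTo n c h)) (sym (*-distribˡ-+ c (sumTo n h) (h (suc n))))

sumTo-reverse : ∀ n h → sumTo n h ≡ sumTo n (λ a → h (n ∸ a))
sumTo-reverse zero    h = refl
sumTo-reverse (suc n) h = begin
  sumTo n h + h (suc n)                      ≡⟨ +-comm (sumTo n h) (h (suc n)) ⟩
  h (suc n) + sumTo n h                      ≡⟨ cong (h (suc n) +_) (sumTo-reverse n h) ⟩
  h (suc n) + sumTo n (λ a → h (n ∸ a))      ≡⟨ sym (sumTo-unfoldˡ n (λ a → h (suc n ∸ a))) ⟩
  sumTo (suc n) (λ a → h (suc n ∸ a))        ∎
  where open ≡-Reasoning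

infix 4 _≐_
_≐_ : Coeffs → Coeffs → Set
u ≐ v = ∀ i j → u i j ≡ v i j

≐-refl : ∀ {u} → u ≐ u
≐-refl _ _ = refl

zeroC : Coeffs
zeroC _ _ = 0

mulX mulY : Coeffs → Coeffs
mulX u zero    j = 0
mulX u (suc i) j = u i j
mulY u i zero    = 0
mulY u i (suc j) = u i j

mulXⁿ mulYⁿ : ℕ → Coeffs → Coeffs
mulXⁿ zero    u = u
mulXⁿ (suc n) u = mulX (mulXⁿ n u)
mulYⁿ zero    u = u
mulYⁿ (suc n) u = mulY (mulYⁿ n u)

mulMonomial : ℕ → ℕ → Coeffs → Coeffs
mulMonomial a b s = mulXⁿ a (mulYⁿ b s)

monomial : ℕ → ℕ → Coeffs
monomial a b = mulMonomial a b oneC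

scale : ℕ → Coeffs → Coeffs
scale c u i j = c * u i j

mulX-cong : ∀ {u v} → u ≐ v → mulX u ≐ mulX v
mulX-cong u≐v zero    j = refl
mulX-cong u≐v (suc i) j = u≐v i j

mulY-cong : ∀ {u v} → u ≐ v → mulY u ≐ mulY v
mulY-cong u≐v i zero    = refl
mulY-cong u≐v i (suc j) = u≐v i j

mulXⁿ-cong : ∀ n {u v} → u ≐ v → mulXⁿ n u ≐ mulXⁿ n v
mulXⁿ-cong zero    u≐v = u≐v
mulXⁿ-cong (suc n) u≐v = mulX-cong (mulXⁿ-cong n u≐v)

mulYⁿ-cong : ∀ n {u v} → u ≐ v → mulYⁿ n u ≐ mulYⁿ n v
mulYⁿ-cong zero    u≐v = u≐v
mulYⁿ-cong (suc n) u≐v = mulY-cong (mulYⁿ-cong n u≐v)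

mulX-addC : ∀ u v → mulX (addC u v) ≐ addC (mulX u) (mulX v)
mulX-addC u v zero    j = refl
mulX-addC u v (suc i) j = refl

mulY-addC : ∀ u v → mulY (addC u v) ≐ addC (mulY u) (mulY v)
mulY-addC u v i zero    = refl
mulY-addC u v i (suc j) = refl

mulX-mulY-comm : ∀ u → mulX (mulY u) ≐ mulY (mulX u)
mulX-mulY-comm u zero    zero    = refl
mulX-mulY-comm u zero    (suc j) = refl
mulX-mulY-comm u (suc i) zero    = refl
mulX-mulY-comm u (suc i) (suc j) = refl

mulXⁿ-below : ∀ n u i j → i < n → mulXⁿ n u i j ≡ 0
mulXⁿ-below (suc n) u zero    j _         = refl
mulXⁿ-below (suc n) u (suc i) j (s≤s i<n) = mulXⁿ-below n u i j i<n

mulXⁿ-above : ∀ n u i j → n ≤ i → mulXⁿ n u i j ≡ u (i ∸ n) j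
mulXⁿ-above zero    u i       j _         = refl
mulXⁿ-above (suc n) u (suc i) j (s≤s n≤i) = mulXⁿ-above n u i j n≤i

mulYⁿ-below : ∀ n u i j → j < n → mulYⁿ n u i j ≡ 0
mulYⁿ-below (suc n) u i zero    _         = refl
mulYⁿ-below (suc n) u i (suc j) (s≤s j<n) = mulYⁿ-below n u i j j<n

mulYⁿ-above : ∀ n u i j → n ≤ j → mulYⁿ n u i j ≡ u i (j ∸ n)
mulYⁿ-above zero    u i j       _         = refl
mulYⁿ-above (suc n) u i (suc j) (s≤s n≤j) = mulYⁿ-above n u i j n≤j

mulMonomial-belowX : ∀ a b s i j → i < a → mulMonomial a b s i j ≡ 0
mulMonomial-belowX a b s = mulXⁿ-below a (mulYⁿ b s)

mulMonomial-belowY : ∀ a b s i j → j < b → mulMonomial a b s i j ≡ 0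
mulMonomial-belowY a b s i j j<b with a ≤? i
... | yes a≤i = trans (mulXⁿ-above a _ i j a≤i) (mulYⁿ-below b s (i ∸ a) j j<b)
... | no  a≰i = mulXⁿ-below a _ i j (≰⇒> a≰i)

mulMonomial-above : ∀ a b s i j → a ≤ i → b ≤ j → mulMonomial a b s i j ≡ s (i ∸ a) (j ∸ b)
mulMonomial-above a b s i j a≤i b≤j = trans (mulXⁿ-above a _ i j a≤i) (mulYⁿ-above b s (i ∸ a) j b≤j)

mulMonomial-+ : ∀ a b s i j → mulMonomial a b s (a + i) (b + j) ≡ s i j
mulMonomial-+ a b s i j =
  trans (mulMonomial-above a b s (a + i) (b + j) (m≤m+n a i) (m≤m+n b j))
        (cong₂ s (m+n∸m≡n a i) (m+n∸m≡n b j))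

monomial-diag : ∀ a b → monomial a b a b ≡ 1
monomial-diag a b =
  trans (sym (cong₂ (monomial a b) (+-identityʳ a) (+-identityʳ b))) (mulMonomial-+ a b oneC 0 0)

monomial-offDiag : ∀ a b i j → ¬ (i ≡ a × j ≡ b) → monomial a b i j ≡ 0
monomial-offDiag a b i j ≢ab with a ≤? i | b ≤? j
... | no a≰i | _        = mulMonomial-belowX a b oneC i j (≰⇒> a≰i)
... | yes _  | no b≰j   = mulMonomial-belowY a b oneC i j (≰⇒> b≰j)
... | yes a≤i | yes b≤j = trans (mulMonomial-above a b oneC i j a≤i b≤j) (oneC-off (i ∸ a) (j ∸ b) ≢00)
  where
  oneC-off : ∀ i j → ¬ (i ≡ 0 × j ≡ 0) → oneC i j ≡ 0
  oneC-off zero    zero    ≢00 = ⊥-elim (≢00 (refl , refl))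
  oneC-off zero    (suc j) _   = refl
  oneC-off (suc i) j       _   = refl
  ≢00 : ¬ (i ∸ a ≡ 0 × j ∸ b ≡ 0)
  ≢00 (i∸a≡0 , j∸b≡0) =
    ≢ab (≤-antisym (m∸n≡0⇒m≤n i∸a≡0) a≤i , ≤-antisym (m∸n≡0⇒m≤n j∸b≡0) b≤j)

mulC-cong : ∀ {u u′ v v′} → u ≐ u′ → v ≐ v′ → mulC u v ≐ mulC u′ v′
mulC-cong u≐u′ v≐v′ i j =
  sumTo-cong i (λ a _ → sumTo-cong j (λ b _ → cong₂ _*_ (u≐u′ a b) (v≐v′ _ _)))

mulC-congˡ : ∀ {u u′} v → u ≐ u′ → mulC u v ≐ mulC u′ v
mulC-congˡ v u≐u′ = mulC-cong u≐u′ (≐-refl {v})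

mulC-congʳ : ∀ u {v v′} → v ≐ v′ → mulC u v ≐ mulC u v′
mulC-congʳ u v≐v′ = mulC-cong (≐-refl {u}) v≐v′

mulC-comm : ∀ u v → mulC u v ≐ mulC v u
mulC-comm u v i j = trans (sumTo-reverse i _) (sumTo-cong i λ a a≤i →
  trans (sumTo-reverse j _) (sumTo-cong j λ b b≤j →
    trans (cong (u (i ∸ a) (j ∸ b) *_) (cong₂ v (m∸[m∸n]≡n a≤i) (m∸[m∸n]≡n b≤j)))
          (*-comm (u (i ∸ a) (j ∸ b)) (v a b))))

mulC-zeroˡ : ∀ v → mulC zeroC v ≐ zeroC
mulC-zeroˡ v i j = sumTo-zero i (λ _ _ → sumTo-zero j (λ _ _ → refl))

mulC-mulXˡ : ∀ u v → mulC (mulX u) v ≐ mulX (mulC u v)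
mulC-mulXˡ u v zero    j = mulC-zeroˡ v 0 j
mulC-mulXˡ u v (suc i) j = trans (sumTo-unfoldˡ i _) (cong (_+ mulC u v i j) (mulC-zeroˡ v 0 j))

mulC-mulYˡ : ∀ u v → mulC (mulY u) v ≐ mulY (mulC u v)
mulC-mulYˡ u v i zero    = mulC-zeroˡ v i 0
mulC-mulYˡ u v i (suc j) = sumTo-cong i (λ a _ → sumTo-unfoldˡ j _)

mulC-mulXʳ : ∀ u v → mulC u (mulX v) ≐ mulX (mulC u v)
mulC-mulXʳ u v i j =
  trans (mulC-comm u (mulX v) i j) (trans (mulC-mulXˡ v u i j) (mulX-cong (mulC-comm v u) i j))

mulC-mulYʳ : ∀ u v → mulC u (mulY v) ≐ mulY (mulC u v)
mulC-mulYʳ u v i j =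
  trans (mulC-comm u (mulY v) i j) (trans (mulC-mulYˡ v u i j) (mulY-cong (mulC-comm v u) i j))

mulC-mulX-move : ∀ u v → mulC (mulX u) v ≐ mulC u (mulX v)
mulC-mulX-move u v i j = trans (mulC-mulXˡ u v i j) (sym (mulC-mulXʳ u v i j))

mulC-mulY-move : ∀ u v → mulC (mulY u) v ≐ mulC u (mulY v)
mulC-mulY-move u v i j = trans (mulC-mulYˡ u v i j) (sym (mulC-mulYʳ u v i j))

mulC-mulXⁿʳ : ∀ n u v → mulC u (mulXⁿ n v) ≐ mulXⁿ n (mulC u v)
mulC-mulXⁿʳ zero    u v = ≐-refl
mulC-mulXⁿʳ (suc n) u v i j = trans (mulC-mulXʳ u (mulXⁿ n v) i j) (mulX-cong (mulC-mulXⁿʳ n u v) i j)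

mulC-mulYⁿʳ : ∀ n u v → mulC u (mulYⁿ n v) ≐ mulYⁿ n (mulC u v)
mulC-mulYⁿʳ zero    u v = ≐-refl
mulC-mulYⁿʳ (suc n) u v i j = trans (mulC-mulYʳ u (mulYⁿ n v) i j) (mulY-cong (mulC-mulYⁿʳ n u v) i j)

mulC-addCˡ : ∀ u u′ v → mulC (addC u u′) v ≐ addC (mulC u v) (mulC u′ v)
mulC-addCˡ u u′ v i j = trans (sumTo-cong i (λ a _ →
    trans (sumTo-cong j (λ b _ → *-distribʳ-+ (v (i ∸ a) (j ∸ b)) (u a b) (u′ a b))) (sumTo-+ j _ _)))
  (sumTo-+ i _ _)

mulC-addCʳ : ∀ u v v′ → mulC u (addC v v′) ≐ addC (mulC u v) (mulC u v′)
mulC-addCʳ u v v′ i j = trans (sumTo-cong i (λ a _ →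
    trans (sumTo-cong j (λ b _ → *-distribˡ-+ (u a b) (v (i ∸ a) (j ∸ b)) (v′ (i ∸ a) (j ∸ b)))) (sumTo-+ j _ _)))
  (sumTo-+ i _ _)

mulC-addCˡ-interchange : ∀ u₁ u₂ v₁ v₂ w₁ w₂ →
  addC (mulC (addC u₁ v₁) w₁) (mulC (addC u₂ v₂) w₂) ≐
  addC (addC (mulC u₁ w₁) (mulC u₂ w₂)) (addC (mulC v₁ w₁) (mulC v₂ w₂))
mulC-addCˡ-interchange u₁ u₂ v₁ v₂ w₁ w₂ i j =
  trans (cong₂ _+_ (mulC-addCˡ u₁ v₁ w₁ i j) (mulC-addCˡ u₂ v₂ w₂ i j))
        (+-interchange (mulC u₁ w₁ i j) (mulC v₁ w₁ i j) (mulC u₂ w₂ i j) (mulC v₂ w₂ i j))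

mulC-scaleˡ : ∀ c u v → mulC (scale c u) v ≐ scale c (mulC u v)
mulC-scaleˡ c u v i j = trans (sumTo-cong i (λ a _ →
    trans (sumTo-cong j (λ b _ → *-assoc c (u a b) _)) (*-distribˡ-sumTo j c _)))
  (*-distribˡ-sumTo i c _)

mulC-scaleʳ : ∀ c u v → mulC u (scale c v) ≐ scale c (mulC u v)
mulC-scaleʳ c u v i j = trans (sumTo-cong i (λ a _ →
    trans (sumTo-cong j (λ b _ → x*[c*y]≡c*[x*y] (u a b) _)) (*-distribˡ-sumTo j c _)))
  (*-distribˡ-sumTo i c _)
  where
  x*[c*y]≡c*[x*y] : ∀ x y → x * (c * y) ≡ c * (x * y)
  x*[c*y]≡c*[x*y] x y = trans (sym (*-assoc x c y)) (trans (cong (_* y) (*-comm x c)) (*-assoc c x y))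

mulC-identityˡ : ∀ v → mulC oneC v ≐ v
mulC-identityˡ v i j =
  trans (sumTo-onlyFirst i (λ a → mulC-zeroˡ v 0 j))
        (trans (sumTo-onlyFirst j (λ b → refl)) (*-identityˡ (v i j)))

mulC-identityʳ : ∀ v → mulC v oneC ≐ v
mulC-identityʳ v i j = trans (mulC-comm v oneC i j) (mulC-identityˡ v i j)

mulC-constˡ : ∀ c v → mulC (scale c oneC) v ≐ scale c v
mulC-constˡ c v i j = trans (mulC-scaleˡ c oneC v i j) (cong (c *_) (mulC-identityˡ v i j))

mulC-monomialʳ : ∀ a b s → mulC s (monomial a b) ≐ mulMonomial a b s
mulC-monomialʳ a b s i j = trans (mulC-mulXⁿʳ a s (mulYⁿ b oneC) i j)
  (mulXⁿ-cong a (λ i′ j′ → trans (mulC-mulYⁿʳ b s oneC i′ j′)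
                                  (mulYⁿ-cong b (mulC-identityʳ s) i′ j′)) i j)

mulC-xCˡ : ∀ v → mulC xC v ≐ mulX v
mulC-xCˡ v i j = trans (mulC-congˡ v xC≐mulX-oneC i j) (trans (mulC-mulXˡ oneC v i j) (mulX-cong (mulC-identityˡ v) i j))
  where
  xC≐mulX-oneC : xC ≐ mulX oneC
  xC≐mulX-oneC zero          j       = refl
  xC≐mulX-oneC (suc zero)    zero    = refl
  xC≐mulX-oneC (suc zero)    (suc j) = refl
  xC≐mulX-oneC (suc (suc i)) j       = refl

mulC-yCˡ : ∀ v → mulC yC v ≐ mulY v
mulC-yCˡ v i j = trans (mulC-congˡ v yC≐mulY-oneC i j) (trans (mulC-mulYˡ oneC v i j) (mulY-cong (mulC-identityˡ v) i j))
  where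
  yC≐mulY-oneC : yC ≐ mulY oneC
  yC≐mulY-oneC zero    zero          = refl
  yC≐mulY-oneC (suc i) zero          = refl
  yC≐mulY-oneC zero    (suc zero)    = refl
  yC≐mulY-oneC (suc i) (suc zero)    = refl
  yC≐mulY-oneC zero    (suc (suc j)) = refl
  yC≐mulY-oneC (suc i) (suc (suc j)) = refl

mulC-xyCˡ : ∀ v → mulC xyC v ≐ addC (mulX v) (mulY v)
mulC-xyCˡ v i j = trans (mulC-addCˡ xC yC v i j) (cong₂ _+_ (mulC-xCˡ v i j) (mulC-yCˡ v i j))

mulC-powC-xCˡ : ∀ n v → mulC (powC xC n) v ≐ mulXⁿ n v
mulC-powC-xCˡ zero    v = mulC-identityˡ v
mulC-powC-xCˡ (suc n) v i j = trans (mulC-congˡ v (mulC-xCˡ (powC xC n)) i j)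
  (trans (mulC-mulXˡ (powC xC n) v i j) (mulX-cong (mulC-powC-xCˡ n v) i j))

mulC-powC-yCˡ : ∀ n v → mulC (powC yC n) v ≐ mulYⁿ n v
mulC-powC-yCˡ zero    v = mulC-identityˡ v
mulC-powC-yCˡ (suc n) v i j = trans (mulC-congˡ v (mulC-yCˡ (powC yC n)) i j)
  (trans (mulC-mulYˡ (powC yC n) v i j) (mulY-cong (mulC-powC-yCˡ n v) i j))

mulC-belowX : ∀ n u v i j → (∀ i′ j′ → i′ < n → v i′ j′ ≡ 0) → i < n → mulC u v i j ≡ 0
mulC-belowX n u v i j v≡0 i<n = sumTo-zero i (λ a _ → sumTo-zero j (λ b _ →
  trans (cong (u a b *_) (v≡0 (i ∸ a) (j ∸ b) (≤-<-trans (m∸n≤m i a) i<n))) (*-zeroʳ (u a b))))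

mulC-belowY : ∀ n u v i j → (∀ i′ j′ → j′ < n → v i′ j′ ≡ 0) → j < n → mulC u v i j ≡ 0
mulC-belowY n u v i j v≡0 j<n = sumTo-zero i (λ a _ → sumTo-zero j (λ b _ →
  trans (cong (u a b *_) (v≡0 (i ∸ a) (j ∸ b) (≤-<-trans (m∸n≤m j b) j<n))) (*-zeroʳ (u a b))))

Homogeneous : ℕ → Coeffs → Set
Homogeneous d u = ∀ i j → ¬ (i + j ≡ d) → u i j ≡ 0

mulX-homogeneous : ∀ {d u} → Homogeneous d u → Homogeneous (suc d) (mulX u)
mulX-homogeneous hom zero    j _      = refl
mulX-homogeneous hom (suc i) j i+j≢d = hom i j (i+j≢d ∘ cong suc)

mulY-homogeneous : ∀ {d u} → Homogeneous d u → Homogeneous (suc d) (mulY u)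
mulY-homogeneous hom i zero    _      = refl
mulY-homogeneous hom i (suc j) i+j≢d = hom i j (λ i+j≡d → i+j≢d (trans (+-suc i j) (cong suc i+j≡d)))

xC-homogeneous : Homogeneous 1 xC
xC-homogeneous zero          j       _   = refl
xC-homogeneous (suc zero)    zero    1≢1 = ⊥-elim (1≢1 refl)
xC-homogeneous (suc zero)    (suc j) _   = refl
xC-homogeneous (suc (suc i)) j       _   = refl

yC-homogeneous : Homogeneous 1 yC
yC-homogeneous zero    zero          _   = refl
yC-homogeneous zero    (suc zero)    1≢1 = ⊥-elim (1≢1 refl)
yC-homogeneous zero    (suc (suc j)) _   = refl
yC-homogeneous (suc i) zero          _   = refl
yC-homogeneous (suc i) (suc j)       _   = refl

powC-xyC-homogeneous : ∀ m → Homogeneous m (powC xyC m)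
powC-xyC-homogeneous zero    zero    zero    0≢0 = ⊥-elim (0≢0 refl)
powC-xyC-homogeneous zero    zero    (suc j) _   = refl
powC-xyC-homogeneous zero    (suc i) j       _   = refl
powC-xyC-homogeneous (suc m) i j i+j≢m = trans (mulC-xyCˡ (powC xyC m) i j)
  (cong₂ _+_ (mulX-homogeneous (powC-xyC-homogeneous m) i j i+j≢m)
             (mulY-homogeneous (powC-xyC-homogeneous m) i j i+j≢m))

powC-xyC-binomial : ∀ m i j → i + j ≡ m → powC xyC m i j ≡ m C i
powC-xyC-binomial zero    zero    zero    _  = refl
powC-xyC-binomial (suc m) zero    (suc j) eq =
  trans (mulC-xyCˡ (powC xyC m) 0 (suc j)) (powC-xyC-binomial m 0 j (suc-injective eq))
powC-xyC-binomial (suc m) (suc i) zero    eq with trans (sym (+-identityʳ i)) (suc-injective eq)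
... | refl = begin
  powC xyC (suc i) (suc i) 0  ≡⟨ mulC-xyCˡ (powC xyC i) (suc i) 0 ⟩
  powC xyC i i 0 + 0          ≡⟨ +-identityʳ _ ⟩
  powC xyC i i 0              ≡⟨ powC-xyC-binomial i i 0 (+-identityʳ i) ⟩
  i C i                       ≡⟨ trans (nCn≡1 i) (sym (nCn≡1 (suc i))) ⟩
  suc i C suc i               ∎
  where open ≡-Reasoning
powC-xyC-binomial (suc m) (suc i) (suc j) eq = begin
  powC xyC (suc m) (suc i) (suc j)            ≡⟨ mulC-xyCˡ (powC xyC m) (suc i) (suc j) ⟩
  powC xyC m i (suc j) + powC xyC m (suc i) j ≡⟨ cong₂ _+_ (powC-xyC-binomial m i (suc j) i+[1+j]≡m)
                                                           (powC-xyC-binomial m (suc i) j [1+i]+j≡m) ⟩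
  m C i + m C suc i                           ≡⟨ nCk+nC[k+1]≡[n+1]C[k+1] m i ⟩
  suc m C suc i                               ∎
  where
  open ≡-Reasoning
  i+[1+j]≡m : i + suc j ≡ m
  i+[1+j]≡m = suc-injective eq
  [1+i]+j≡m : suc i + j ≡ m
  [1+i]+j≡m = trans (sym (+-suc i j)) i+[1+j]≡m

mulC-powC-xyC-suc : ∀ m w → mulC (powC xyC (suc m)) w ≐ addC (mulX (mulC (powC xyC m) w)) (mulY (mulC (powC xyC m) w))
mulC-powC-xyC-suc m w i j = begin
  mulC (powC xyC (suc m)) w i j
    ≡⟨ mulC-congˡ w (mulC-xyCˡ (powC xyC m)) i j ⟩
  mulC (addC (mulX (powC xyC m)) (mulY (powC xyC m))) w i j
    ≡⟨ mulC-addCˡ (mulX (powC xyC m)) (mulY (powC xyC m)) w i j ⟩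
  mulC (mulX (powC xyC m)) w i j + mulC (mulY (powC xyC m)) w i j
    ≡⟨ cong₂ _+_ (mulC-mulXˡ (powC xyC m) w i j) (mulC-mulYˡ (powC xyC m) w i j) ⟩
  mulX (mulC (powC xyC m) w) i j + mulY (mulC (powC xyC m) w) i j ∎
  where open ≡-Reasoning

mulC-powC-xyC-lowDeg : ∀ m H i j → i + j ≤ m → mulC (powC xyC m) H i j ≡ powC xyC m i j * H 0 0
mulC-powC-xyC-lowDeg m H i j i+j≤m = begin
  mulC (powC xyC m) H i j
    ≡⟨ sumTo-onlyLast i (λ a a<i → sumTo-zero j (λ b b≤j → vanishes (+-mono-<-≤ a<i b≤j))) ⟩
  sumTo j (λ b → powC xyC m i b * H (i ∸ i) (j ∸ b))
    ≡⟨ sumTo-onlyLast j (λ b b<j → vanishes (+-monoʳ-< i b<j)) ⟩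
  powC xyC m i j * H (i ∸ i) (j ∸ j)
    ≡⟨ cong₂ (λ a b → powC xyC m i j * H a b) (n∸n≡0 i) (n∸n≡0 j) ⟩
  powC xyC m i j * H 0 0 ∎
  where
  open ≡-Reasoning
  vanishes : ∀ {a b c} → a + b < i + j → powC xyC m a b * c ≡ 0
  vanishes {a} {b} {c} a+b<i+j =
    cong (_* c) (powC-xyC-homogeneous m a b (<⇒≢ (<-≤-trans a+b<i+j i+j≤m)))

xHigh xLow : ℕ → Coeffs → Coeffs
xHigh zero    u i       j = u i j
xHigh (suc n) u zero    j = 0
xHigh (suc n) u (suc i) j = xHigh n (u ∘ suc) i j
xLow zero    u i       j = 0
xLow (suc n) u zero    j = u 0 j
xLow (suc n) u (suc i) j = xLow n (u ∘ suc) i j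

xHigh-below : ∀ n u i j → i < n → xHigh n u i j ≡ 0
xHigh-below (suc n) u zero    j _         = refl
xHigh-below (suc n) u (suc i) j (s≤s i<n) = xHigh-below n (u ∘ suc) i j i<n

xHigh-above : ∀ n u i j → n ≤ i → xHigh n u i j ≡ u i j
xHigh-above zero    u i       j _         = refl
xHigh-above (suc n) u (suc i) j (s≤s n≤i) = xHigh-above n (u ∘ suc) i j n≤i

xLow-below : ∀ n u i j → i < n → xLow n u i j ≡ u i j
xLow-below (suc n) u zero    j _         = refl
xLow-below (suc n) u (suc i) j (s≤s i<n) = xLow-below n (u ∘ suc) i j i<n

xLow-above : ∀ n u i j → n ≤ i → xLow n u i j ≡ 0
xLow-above zero    u i       j _         = refl
xLow-above (suc n) u (suc i) j (s≤s n≤i) = xLow-above n (u ∘ suc) i j n≤i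

xHigh+xLow : ∀ n u → addC (xHigh n u) (xLow n u) ≐ u
xHigh+xLow zero    u i       j = +-identityʳ (u i j)
xHigh+xLow (suc n) u zero    j = refl
xHigh+xLow (suc n) u (suc i) j = xHigh+xLow n (u ∘ suc) i j

xHigh-≡0 : ∀ n u i j → u i j ≡ 0 → xHigh n u i j ≡ 0
xHigh-≡0 n u i j u≡0 with n ≤? i
... | yes n≤i = trans (xHigh-above n u i j n≤i) u≡0
... | no  n≰i = xHigh-below n u i j (≰⇒> n≰i)

xLow-≡0 : ∀ n u i j → u i j ≡ 0 → xLow n u i j ≡ 0
xLow-≡0 n u i j u≡0 with n ≤? i
... | yes n≤i = xLow-above n u i j n≤i
... | no  n≰i = trans (xLow-below n u i j (≰⇒> n≰i)) u≡0

xHigh-homogeneous : ∀ n {d u} → Homogeneous d u → Homogeneous d (xHigh n u)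
xHigh-homogeneous n {u = u} hom i j i+j≢d = xHigh-≡0 n u i j (hom i j i+j≢d)

xLow-homogeneous : ∀ n {d u} → Homogeneous d u → Homogeneous d (xLow n u)
xLow-homogeneous n {u = u} hom i j i+j≢d = xLow-≡0 n u i j (hom i j i+j≢d)

mulC-xHigh+xLow : ∀ n w u → addC (mulC w (xHigh n u)) (mulC w (xLow n u)) ≐ mulC w u
mulC-xHigh+xLow n w u i j =
  trans (sym (mulC-addCʳ w (xHigh n u) (xLow n u) i j)) (mulC-congʳ w (xHigh+xLow n u) i j)

module Modular (p : ℕ) .{{_ : NonZero p}} where

  infix 4 _≋_
  record _≋_ (a b : ℕ) : Set where
    constructor mk≋
    field
      %-≡ : a % p ≡ b % p

  ≡⇒≋ : ∀ {a b} → a ≡ b → a ≋ b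
  ≡⇒≋ a≡b = mk≋ (cong (_% p) a≡b)

  ≋-refl : ∀ {a} → a ≋ a
  ≋-refl = mk≋ refl

  ≋-sym : ∀ {a b} → a ≋ b → b ≋ a
  ≋-sym (mk≋ e) = mk≋ (sym e)

  ≋-trans : ∀ {a b c} → a ≋ b → b ≋ c → a ≋ c
  ≋-trans (mk≋ e) (mk≋ e′) = mk≋ (trans e e′)

  ≋-setoid : Setoid _ _
  ≋-setoid = record
    { Carrier = ℕ ; _≈_ = _≋_
    ; isEquivalence = record { refl = ≋-refl ; sym = ≋-sym ; trans = ≋-trans } }

  module ≋-Reasoning = SetoidReasoning ≋-setoid

  ModEq⇒≋ : ∀ {a b} → ModEq p a b → a ≋ b
  ModEq⇒≋ {a} {b} (k , l , a+kp≡b+lp) = mk≋ (begin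
    a % p            ≡⟨ sym ([m+kn]%n≡m%n a k p) ⟩
    (a + k * p) % p  ≡⟨ cong (_% p) a+kp≡b+lp ⟩
    (b + l * p) % p  ≡⟨ [m+kn]%n≡m%n b l p ⟩
    b % p            ∎)
    where open ≡-Reasoning

  ≋⇒ModEq : ∀ {a b} → a ≋ b → ModEq p a b
  ≋⇒ModEq {a} {b} (mk≋ a%p≡b%p) = b / p , a / p , (begin
    a + (b / p) * p                      ≡⟨ cong (_+ (b / p) * p) (m≡m%n+[m/n]*n a p) ⟩
    (a % p + (a / p) * p) + (b / p) * p  ≡⟨ cong (λ r → (r + (a / p) * p) + (b / p) * p) a%p≡b%p ⟩
    (b % p + (a / p) * p) + (b / p) * p  ≡⟨ +-exchangeʳ (b % p) ((a / p) * p) ((b / p) * p) ⟩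
    (b % p + (b / p) * p) + (a / p) * p  ≡⟨ cong (_+ (a / p) * p) (sym (m≡m%n+[m/n]*n b p)) ⟩
    b + (a / p) * p                      ∎)
    where open ≡-Reasoning

  +-cong-≋ : ∀ {a a′ b b′} → a ≋ a′ → b ≋ b′ → a + b ≋ a′ + b′
  +-cong-≋ {a} {a′} {b} {b′} (mk≋ a≋a′) (mk≋ b≋b′) = mk≋ (begin
    (a + b) % p                ≡⟨ %-distribˡ-+ a b p ⟩
    (a % p + b % p) % p        ≡⟨ cong₂ (λ x y → (x + y) % p) a≋a′ b≋b′ ⟩
    (a′ % p + b′ % p) % p      ≡⟨ sym (%-distribˡ-+ a′ b′ p) ⟩
    (a′ + b′) % p              ∎)
    where open ≡-Reasoning

  *-cong-≋ : ∀ {a a′ b b′} → a ≋ a′ → b ≋ b′ → a * b ≋ a′ * b′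
  *-cong-≋ {a} {a′} {b} {b′} (mk≋ a≋a′) (mk≋ b≋b′) = mk≋ (begin
    (a * b) % p                ≡⟨ %-distribˡ-* a b p ⟩
    (a % p * (b % p)) % p      ≡⟨ cong₂ (λ x y → (x * y) % p) a≋a′ b≋b′ ⟩
    (a′ % p * (b′ % p)) % p    ≡⟨ sym (%-distribˡ-* a′ b′ p) ⟩
    (a′ * b′) % p              ∎)
    where open ≡-Reasoning

  -- ℕ has no additive inverses; modulo p, −x is represented by (p − 1)·x.
  neg : ℕ → ℕ
  neg x = pred p * x

  *p≋0 : ∀ x → x * p ≋ 0
  *p≋0 x = mk≋ (trans (m*n%n≡0 x p) (sym (m*n%n≡0 0 p)))

  +-inverseʳ-≋ : ∀ x → x + neg x ≋ 0
  +-inverseʳ-≋ x = ≋-trans (≡⇒≋ (trans (cong (_* x) (suc-pred p)) (*-comm p x))) (*p≋0 x)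

  ∣⇒≋0 : ∀ {c} → p ∣ c → c ≋ 0
  ∣⇒≋0 (divides q c≡qp) = ≋-trans (≡⇒≋ c≡qp) (*p≋0 q)

  *-zeroˡ-≋ : ∀ {x} y → x ≋ 0 → x * y ≋ 0
  *-zeroˡ-≋ y x≋0 = *-cong-≋ x≋0 (≋-refl {y})

  *-zeroʳ-≋ : ∀ x {y} → y ≋ 0 → x * y ≋ 0
  *-zeroʳ-≋ x y≋0 = ≋-trans (*-cong-≋ (≋-refl {x}) y≋0) (≡⇒≋ (*-zeroʳ x))

  +-identityʳ-≋ : ∀ {x y} → y ≋ 0 → x + y ≋ x
  +-identityʳ-≋ {x} y≋0 = ≋-trans (+-cong-≋ (≋-refl {x}) y≋0) (≡⇒≋ (+-identityʳ x))

  +-identityˡ-≋ : ∀ {x y} → x ≋ 0 → x + y ≋ y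
  +-identityˡ-≋ {y = y} x≋0 = +-cong-≋ x≋0 (≋-refl {y})

  +-cancelʳ-≋ : ∀ {a b c} → a + c ≋ b + c → a ≋ b
  +-cancelʳ-≋ {a} {b} {c} a+c≋b+c = begin
    a                  ≈⟨ +-identityʳ-≋ (+-inverseʳ-≋ c) ⟨
    a + (c + neg c)    ≡⟨ sym (+-assoc a c (neg c)) ⟩
    (a + c) + neg c    ≈⟨ +-cong-≋ a+c≋b+c ≋-refl ⟩
    (b + c) + neg c    ≡⟨ +-assoc b c (neg c) ⟩
    b + (c + neg c)    ≈⟨ +-identityʳ-≋ (+-inverseʳ-≋ c) ⟩
    b                  ∎
    where open ≋-Reasoning

  +≋0⇒≋neg : ∀ {x y} → x + y ≋ 0 → y ≋ neg x
  +≋0⇒≋neg {x} {y} x+y≋0 = +-cancelʳ-≋ {c = x} (begin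
    y + x          ≡⟨ +-comm y x ⟩
    x + y          ≈⟨ x+y≋0 ⟩
    0              ≈⟨ +-inverseʳ-≋ x ⟨
    x + neg x      ≡⟨ +-comm x (neg x) ⟩
    neg x + x      ∎)
    where open ≋-Reasoning

  sumTo-cong-≋ : ∀ n {h h′ : ℕ → ℕ} → (∀ a → a ≤ n → h a ≋ h′ a) → sumTo n h ≋ sumTo n h′
  sumTo-cong-≋ zero    h≋h′ = h≋h′ 0 z≤n
  sumTo-cong-≋ (suc n) h≋h′ =
    +-cong-≋ (sumTo-cong-≋ n (λ a a≤n → h≋h′ a (m≤n⇒m≤1+n a≤n))) (h≋h′ (suc n) ≤-refl)

  sumTo-≋0 : ∀ n {h : ℕ → ℕ} → (∀ a → a ≤ n → h a ≋ 0) → sumTo n h ≋ 0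
  sumTo-≋0 n h≋0 = ≋-trans (sumTo-cong-≋ n h≋0) (≡⇒≋ (sumTo-zero n (λ _ _ → refl)))

  infix 4 _≈_
  _≈_ : Coeffs → Coeffs → Set
  u ≈ v = ∀ i j → u i j ≋ v i j

  ≈-refl : ∀ {u} → u ≈ u
  ≈-refl _ _ = ≋-refl

  mulC-cong-≋ : ∀ {u u′ v v′} → u ≈ u′ → v ≈ v′ → mulC u v ≈ mulC u′ v′
  mulC-cong-≋ u≈u′ v≈v′ i j =
    sumTo-cong-≋ i (λ a _ → sumTo-cong-≋ j (λ b _ → *-cong-≋ (u≈u′ a b) (v≈v′ _ _)))

  mulC-≋0 : ∀ u v i j → (∀ a b → a ≤ i → b ≤ j → u a b * v (i ∸ a) (j ∸ b) ≋ 0) → mulC u v i j ≋ 0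
  mulC-≋0 u v i j terms≋0 = sumTo-≋0 i (λ a a≤i → sumTo-≋0 j (λ b b≤j → terms≋0 a b a≤i b≤j))

  VanishesFrom : ℕ → Coeffs → Set
  VanishesFrom B u = ∀ i j → B ≤ i + j → u i j ≋ 0

  toPoly : (u : Coeffs) (B : ℕ) → VanishesFrom B u → Poly p
  toPoly u B u≋0 = poly u B (λ i j B≤i+j → ≋⇒ModEq (u≋0 i j B≤i+j))

  poly-vanishesFrom : (f : Poly p) → VanishesFrom (bound f) (coeff f)
  poly-vanishesFrom f i j B≤i+j = ModEq⇒≋ (finite f i j B≤i+j)

  homogeneous⇒vanishesFrom : ∀ {d u} → Homogeneous d u → VanishesFrom (suc d) u
  homogeneous⇒vanishesFrom hom i j d<i+j = ≡⇒≋ (hom i j (λ i+j≡d → <⇒≢ d<i+j (sym i+j≡d)))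

  vanishesFrom-mono : ∀ {B B′ u} → B ≤ B′ → VanishesFrom B u → VanishesFrom B′ u
  vanishesFrom-mono B≤B′ u≋0 i j B′≤i+j = u≋0 i j (≤-trans B≤B′ B′≤i+j)

  vanishesFrom-addC : ∀ {B u v} → VanishesFrom B u → VanishesFrom B v → VanishesFrom B (addC u v)
  vanishesFrom-addC u≋0 v≋0 i j B≤i+j = +-cong-≋ (u≋0 i j B≤i+j) (v≋0 i j B≤i+j)

  vanishesFrom-scale : ∀ {B u} c → VanishesFrom B u → VanishesFrom B (scale c u)
  vanishesFrom-scale c u≋0 i j B≤i+j = *-zeroʳ-≋ c (u≋0 i j B≤i+j)

  vanishesFrom-mulX : ∀ {B u} → VanishesFrom B u → VanishesFrom (suc B) (mulX u)
  vanishesFrom-mulX u≋0 zero    j _           = ≋-refl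
  vanishesFrom-mulX u≋0 (suc i) j (s≤s B≤i+j) = u≋0 i j B≤i+j

  vanishesFrom-mulY : ∀ {B u} → VanishesFrom B u → VanishesFrom (suc B) (mulY u)
  vanishesFrom-mulY u≋0 i zero    _           = ≋-refl
  vanishesFrom-mulY {B} u≋0 i (suc j) B<i+1+j = u≋0 i j (≤-pred (subst (suc B ≤_) (+-suc i j) B<i+1+j))

  vanishesFrom-mulC : ∀ {B₁ B₂ u v} → VanishesFrom B₁ u → VanishesFrom B₂ v →
                      VanishesFrom (B₁ + B₂) (mulC u v)
  vanishesFrom-mulC {B₁} {B₂} {u} {v} u≋0 v≋0 i j B₁+B₂≤i+j = mulC-≋0 u v i j term≋0
    where
    term≋0 : ∀ a b → a ≤ i → b ≤ j → u a b * v (i ∸ a) (j ∸ b) ≋ 0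
    term≋0 a b a≤i b≤j with B₁ ≤? a + b
    ... | yes B₁≤a+b = *-zeroˡ-≋ _ (u≋0 a b B₁≤a+b)
    ... | no  B₁≰a+b = *-zeroʳ-≋ (u a b) (v≋0 (i ∸ a) (j ∸ b) (+-cancelʳ-≤ (a + b) B₂ _ (begin
      B₂ + (a + b)                 ≤⟨ +-monoʳ-≤ B₂ (<⇒≤ (≰⇒> B₁≰a+b)) ⟩
      B₂ + B₁                      ≡⟨ +-comm B₂ B₁ ⟩
      B₁ + B₂                      ≤⟨ B₁+B₂≤i+j ⟩
      i + j                        ≡⟨ sym (cong₂ _+_ (m∸n+n≡m a≤i) (m∸n+n≡m b≤j)) ⟩
      (i ∸ a + a) + (j ∸ b + b)    ≡⟨ +-interchange (i ∸ a) a (j ∸ b) b ⟩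
      (i ∸ a + (j ∸ b)) + (a + b)  ∎)))
      where open ≤-Reasoning

  -- x + y is not a zero divisor: compare the coefficients of lowest x-degree.
  mulC-xyC-cancel : ∀ u → (∀ i j → mulX u i j + mulY u i j ≋ 0) → u ≈ zeroC
  mulC-xyC-cancel u xu+yu≋0 zero    j = xu+yu≋0 0 (suc j)
  mulC-xyC-cancel u xu+yu≋0 (suc i) j =
    ≋-trans (≋-sym (+-identityˡ-≋ (mulC-xyC-cancel u xu+yu≋0 i (suc j)))) (xu+yu≋0 (suc i) (suc j))

  mulC-powC-xyC-cancel : ∀ m w → mulC (powC xyC m) w ≈ zeroC → w ≈ zeroC
  mulC-powC-xyC-cancel zero    w Pw≋0 i j = ≋-trans (≡⇒≋ (sym (mulC-identityˡ w i j))) (Pw≋0 i j)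
  mulC-powC-xyC-cancel (suc m) w Pw≋0 = mulC-powC-xyC-cancel m w (mulC-xyC-cancel (mulC (powC xyC m) w)
    (λ i j → ≋-trans (≡⇒≋ (sym (mulC-powC-xyC-suc m w i j))) (Pw≋0 i j)))

  constPoly : ℕ → Poly p
  constPoly c = toPoly (scale c oneC) 1 const-vanishes
    where
    const-vanishes : VanishesFrom 1 (scale c oneC)
    const-vanishes zero    (suc j) _ = *-zeroʳ-≋ c ≋-refl
    const-vanishes (suc i) j       _ = *-zeroʳ-≋ c ≋-refl

  module Membership (μ₁ μ₂ m : ℕ) where

    InD-xPart-below : ∀ {f g} → InD p μ₁ μ₂ m (f , g) → ∀ i j → i < μ₁ → coeff f i j ≋ 0
    InD-xPart-below ((h , f≋xᵘh) , _) i j i<μ₁ = ≋-trans (ModEq⇒≋ (f≋xᵘh i j))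
      (≡⇒≋ (trans (mulC-powC-xCˡ μ₁ (coeff h) i j) (mulXⁿ-below μ₁ (coeff h) i j i<μ₁)))

    InD-yPart-below : ∀ {f g} → InD p μ₁ μ₂ m (f , g) → ∀ i j → j < μ₂ → coeff g i j ≋ 0
    InD-yPart-below (_ , (h , g≋yᵘh) , _) i j j<μ₂ = ≋-trans (ModEq⇒≋ (g≋yᵘh i j))
      (≡⇒≋ (trans (mulC-powC-yCˡ μ₂ (coeff h) i j) (mulYⁿ-below μ₂ (coeff h) i j j<μ₂)))

    InD-sum : ∀ {f g} → InD p μ₁ μ₂ m (f , g) →
              Σ (Poly p) λ h → ∀ i j → coeff f i j + coeff g i j ≋ mulC (powC xyC m) (coeff h) i j
    InD-sum (_ , _ , h , f+g≋Ph) = h , λ i j → ModEq⇒≋ (f+g≋Ph i j)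

  divByX : ∀ (f : Poly p) n → (∀ i j → i < n → coeff f i j ≋ 0) → DivBy p xC n f
  divByX f n f≋0 = toPoly h (bound f) h-vanishes , λ i j → ≋⇒ModEq (f≋xⁿh i j)
    where
    h : Coeffs
    h i j = coeff f (n + i) j
    h-vanishes : VanishesFrom (bound f) h
    h-vanishes i j B≤i+j = poly-vanishesFrom f (n + i) j (≤-trans B≤i+j (+-monoˡ-≤ j (m≤n+m i n)))
    f≋xⁿh : ∀ i j → coeff f i j ≋ mulC (powC xC n) h i j
    f≋xⁿh i j with n ≤? i
    ... | yes n≤i = ≡⇒≋ (sym (trans (mulC-powC-xCˡ n h i j)
                     (trans (mulXⁿ-above n h i j n≤i) (cong (λ i′ → coeff f i′ j) (m+[n∸m]≡n n≤i)))))
    ... | no  n≰i = ≋-trans (f≋0 i j (≰⇒> n≰i))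
                     (≡⇒≋ (sym (trans (mulC-powC-xCˡ n h i j) (mulXⁿ-below n h i j (≰⇒> n≰i)))))

  divByY : ∀ (g : Poly p) n → (∀ i j → j < n → coeff g i j ≋ 0) → DivBy p yC n g
  divByY g n g≋0 = toPoly h (bound g) h-vanishes , λ i j → ≋⇒ModEq (g≋yⁿh i j)
    where
    h : Coeffs
    h i j = coeff g i (n + j)
    h-vanishes : VanishesFrom (bound g) h
    h-vanishes i j B≤i+j = poly-vanishesFrom g i (n + j) (≤-trans B≤i+j (+-monoʳ-≤ i (m≤n+m j n)))
    g≋yⁿh : ∀ i j → coeff g i j ≋ mulC (powC yC n) h i j
    g≋yⁿh i j with n ≤? j
    ... | yes n≤j = ≡⇒≋ (sym (trans (mulC-powC-yCˡ n h i j)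
                     (trans (mulYⁿ-above n h i j n≤j) (cong (coeff g i) (m+[n∸m]≡n n≤j)))))
    ... | no  n≰j = ≋-trans (g≋0 i j (≰⇒> n≰j))
                     (≡⇒≋ (sym (trans (mulC-powC-yCˡ n h i j) (mulYⁿ-below n h i j (≰⇒> n≰j)))))

  split : ℕ → (w : Coeffs) → ∀ {d} → Homogeneous d w → Der p
  split n w {d} w-hom =
    toPoly (xHigh n w) (suc d) (homogeneous⇒vanishesFrom (xHigh-homogeneous n w-hom)) ,
    toPoly (xLow n w) (suc d) (homogeneous⇒vanishesFrom (xLow-homogeneous n w-hom))

  split-homogeneous : ∀ n w {d} (w-hom : Homogeneous d w) → HomogDer d (split n w w-hom)
  split-homogeneous n w w-hom =
    (λ i j i+j≢d → ≋⇒ModEq (≡⇒≋ (xHigh-homogeneous n w-hom i j i+j≢d))) ,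
    (λ i j i+j≢d → ≋⇒ModEq (≡⇒≋ (xLow-homogeneous n w-hom i j i+j≢d)))

  split-InD : ∀ n b m w {d} (w-hom : Homogeneous d w) (h : Poly p) → w ≐ mulC (powC xyC m) (coeff h) →
              (∀ i j → j < b → xLow n w i j ≋ 0) → InD p n b m (split n w w-hom)
  split-InD n b m w w-hom h w≐Ph yPart≋0 =
    divByX (proj₁ (split n w w-hom)) n (λ i j i<n → ≡⇒≋ (xHigh-below n w i j i<n)) ,
    divByY (proj₂ (split n w w-hom)) b yPart≋0 ,
    (h , λ i j → ≋⇒ModEq (≡⇒≋ (trans (xHigh+xLow n w i j) (w≐Ph i j))))

  mulC-homogeneous-belowDeg : ∀ {d} u v → HomogC p d v → ∀ i j → i + j < d → mulC u v i j ≋ 0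
  mulC-homogeneous-belowDeg {d} u v v-hom i j i+j<d = mulC-≋0 u v i j λ a b _ _ →
    *-zeroʳ-≋ (u a b) (ModEq⇒≋ (v-hom (i ∸ a) (j ∸ b) λ eq →
      <⇒≢ (≤-<-trans (+-mono-≤ (m∸n≤m i a) (m∸n≤m j b)) i+j<d) eq))

  combination-belowDeg : ∀ {d} u₁ u₂ v₁ v₂ → HomogC p d v₁ → HomogC p d v₂ →
                         ∀ i j → i + j < d → mulC u₁ v₁ i j + mulC u₂ v₂ i j ≋ 0
  combination-belowDeg u₁ u₂ v₁ v₂ v₁-hom v₂-hom i j i+j<d = +-cong-≋
    (mulC-homogeneous-belowDeg u₁ v₁ v₁-hom i j i+j<d) (mulC-homogeneous-belowDeg u₂ v₂ v₂-hom i j i+j<d)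

module PrimeField (p : ℕ) (p-prime : Prime p) where

  private instance
    p≢0 : NonZero p
    p≢0 = prime⇒nonZero p-prime

  open Modular p public

  1≉0 : ¬ (1 ≋ 0)
  1≉0 (mk≋ 1%p≡0%p) = contradiction (trans (sym (m<n⇒m%n≡m 1<p)) (trans 1%p≡0%p (m*n%n≡0 0 p))) λ ()
    where
    1<p : 1 < p
    1<p = nonTrivial⇒n>1 p {{prime⇒nonTrivial p-prime}}

  ∤⇒coprime : ∀ {c} → ¬ p ∣ c → Coprime p c
  ∤⇒coprime p∤c (d∣p , d∣c) with prime⇒irreducible p-prime d∣p
  ... | inj₁ d≡1 = d≡1
  ... | inj₂ refl = contradiction d∣c p∤c

  inverse : ∀ {c} → ¬ p ∣ c → Σ ℕ λ κ → κ * c ≋ 1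
  inverse {c} p∤c with coprime-Bézout (∤⇒coprime p∤c)
  ... | Bézout.-+ x y 1+xp≡yc = y , (begin
    y * c      ≡⟨ sym 1+xp≡yc ⟩
    1 + x * p  ≈⟨ +-identityʳ-≋ (*p≋0 x) ⟩
    1          ∎)
    where open ≋-Reasoning
  ... | Bézout.+- x y 1+yc≡xp = neg y , (begin
    neg y * c    ≡⟨ *-assoc (pred p) y c ⟩
    neg (y * c)  ≈⟨ +≋0⇒≋neg yc+1≋0 ⟨
    1            ∎)
    where
    open ≋-Reasoning
    yc+1≋0 : y * c + 1 ≋ 0
    yc+1≋0 = ≋-trans (≡⇒≋ (trans (+-comm (y * c) 1) 1+yc≡xp)) (*p≋0 x)

  independent-const : ∀ {a b m F₁ G₁ F₂ G₂} → IsBasis p a b m (F₁ , G₁) (F₂ , G₂) → ∀ c₁ c₂ →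
    (∀ i j → c₁ * coeff F₁ i j + c₂ * coeff F₂ i j ≋ 0) →
    (∀ i j → c₁ * coeff G₁ i j + c₂ * coeff G₂ i j ≋ 0) → c₁ ≋ 0 × c₂ ≋ 0
  independent-const {F₁ = F₁} {G₁} {F₂} {G₂} (_ , _ , _ , independent) c₁ c₂ F≋0 G≋0 =
    const≋0 c₁ (proj₁ consts≈0) , const≋0 c₂ (proj₂ consts≈0)
    where
    combination≋0 : ∀ u₁ u₂ → (∀ i j → c₁ * u₁ i j + c₂ * u₂ i j ≋ 0) →
      ∀ i j → ModEq p (addC (mulC (scale c₁ oneC) u₁) (mulC (scale c₂ oneC) u₂) i j) 0
    combination≋0 u₁ u₂ u≋0 i j = ≋⇒ModEq
      (≋-trans (≡⇒≋ (cong₂ _+_ (mulC-constˡ c₁ u₁ i j) (mulC-constˡ c₂ u₂ i j))) (u≋0 i j))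
    consts≈0 : (∀ i j → ModEq p (scale c₁ oneC i j) 0) × (∀ i j → ModEq p (scale c₂ oneC i j) 0)
    consts≈0 = independent (constPoly c₁) (constPoly c₂)
      (combination≋0 (coeff F₁) (coeff F₂) F≋0) (combination≋0 (coeff G₁) (coeff G₂) G≋0)
    const≋0 : ∀ c → (∀ i j → ModEq p (scale c oneC i j) 0) → c ≋ 0
    const≋0 c c≋0 = ≋-trans (≡⇒≋ (sym (*-identityʳ c))) (ModEq⇒≋ (c≋0 0 0))

  basis-first≉0 : ∀ {a b m F₁ G₁ θ₂} → IsBasis p a b m (F₁ , G₁) θ₂ →
                  coeff F₁ ≈ zeroC → coeff G₁ ≈ zeroC → ⊥
  basis-first≉0 {a} {b} {m} {F₁} {G₁} {F₂ , G₂} basis F₁≈0 G₁≈0 =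
    1≉0 (proj₁ (independent-const {a} {b} {m} {F₁} {G₁} {F₂} {G₂} basis 1 0
                                  (only-first F₁≈0) (only-first G₁≈0)))
    where
    only-first : ∀ {u} → u ≈ zeroC → ∀ i j → 1 * u i j + 0 ≋ 0
    only-first {u} u≈0 i j = ≋-trans (≡⇒≋ (trans (+-identityʳ _) (*-identityˡ (u i j)))) (u≈0 i j)

  multiples-dependent : ∀ {x₁ x₂} u₁ u₂ z → x₁ ≋ u₁ * z → x₂ ≋ u₂ * z → u₂ * x₁ + neg u₁ * x₂ ≋ 0
  multiples-dependent u₁ u₂ z x₁≋u₁z x₂≋u₂z = begin
    u₂ * _ + neg u₁ * _
      ≈⟨ +-cong-≋ (*-cong-≋ (≋-refl {u₂}) x₁≋u₁z) (*-cong-≋ (≋-refl {neg u₁}) x₂≋u₂z) ⟩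
    u₂ * (u₁ * z) + pred p * u₁ * (u₂ * z)     ≡⟨ rearrange (pred p) u₁ u₂ z ⟩
    u₁ * u₂ * z + neg (u₁ * u₂ * z)            ≈⟨ +-inverseʳ-≋ (u₁ * u₂ * z) ⟩
    0                                          ∎
    where
    open ≋-Reasoning
    rearrange : ∀ q u₁ u₂ z → u₂ * (u₁ * z) + q * u₁ * (u₂ * z) ≡ u₁ * u₂ * z + q * (u₁ * u₂ * z)
    rearrange = solve-∀

  -- Obstructions to a basis with equal exponents

  module Obstruction (a b m : ℕ) (a+b≡2+m : a + b ≡ 2 + m) where

    open Membership a b m

    P : Coeffs
    P = powC xyC m

    ζ : Der p
    ζ = split a P (powC-xyC-homogeneous m)

    ¬[a≤i∧b≤j∧i+j≤m] : ∀ {i j} → a ≤ i → b ≤ j → i + j ≤ m → ⊥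
    ¬[a≤i∧b≤j∧i+j≤m] {i} {j} a≤i b≤j i+j≤m = 1+n≰n (begin
      suc m      ≤⟨ n≤1+n (suc m) ⟩
      2 + m      ≡⟨ a+b≡2+m ⟨
      a + b      ≤⟨ +-mono-≤ a≤i b≤j ⟩
      i + j      ≤⟨ i+j≤m ⟩
      m          ∎)
      where open ≤-Reasoning

    i<a∧j<b∧i+j≡m⇒a≡1+i : ∀ {i j} → i < a → j < b → i + j ≡ m → a ≡ suc i
    i<a∧j<b∧i+j≡m⇒a≡1+i {i} {j} i<a j<b i+j≡m = ≤-antisym (+-cancelʳ-≤ b a (suc i) (begin
      a + b          ≡⟨ a+b≡2+m ⟩
      2 + m          ≡⟨ cong (2 +_) (sym i+j≡m) ⟩
      2 + (i + j)    ≡⟨ cong suc (sym (+-suc i j)) ⟩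
      suc i + suc j  ≤⟨ +-monoʳ-≤ (suc i) j<b ⟩
      suc i + b      ∎)) i<a
      where open ≤-Reasoning

    ζ-yPart-below : p ∣ binomPred m a → ∀ i j → j < b → xLow a P i j ≋ 0
    ζ-yPart-below p∣binom i j j<b with a ≤? i
    ... | yes a≤i = ≡⇒≋ (xLow-above a P i j a≤i)
    ... | no  a≰i with i + j ≟ m
    ...   | no  i+j≢m = ≡⇒≋ (trans (xLow-below a P i j (≰⇒> a≰i)) (powC-xyC-homogeneous m i j i+j≢m))
    ...   | yes i+j≡m = ≋-trans
      (≡⇒≋ (trans (xLow-below a P i j (≰⇒> a≰i)) (powC-xyC-binomial m i j i+j≡m)))
      (∣⇒≋0 (subst (λ n → p ∣ binomPred m n) (i<a∧j<b∧i+j≡m⇒a≡1+i (≰⇒> a≰i) j<b i+j≡m) p∣binom))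

    ζ-InD : p ∣ binomPred m a → InD p a b m ζ
    ζ-InD p∣binom = split-InD a b m P (powC-xyC-homogeneous m) (constPoly 1) P≐P*1 (ζ-yPart-below p∣binom)
      where
      P≐P*1 : P ≐ mulC P (scale 1 oneC)
      P≐P*1 i j = sym (trans (mulC-scaleʳ 1 P oneC i j) (trans (*-identityˡ _) (mulC-identityʳ P i j)))

    ζ-unitCoeff : xHigh a P m 0 ≡ 1 ⊎ xLow a P 0 m ≡ 1
    ζ-unitCoeff with a ≤? m
    ... | yes a≤m = inj₁ (trans (xHigh-above a P m 0 a≤m)
                          (trans (powC-xyC-binomial m m 0 (+-identityʳ m)) (nCn≡1 m)))
    ... | no  a≰m = inj₂ (trans (xLow-below a P 0 m (≤-<-trans z≤n (≰⇒> a≰m)))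
                          (powC-xyC-binomial m 0 m refl))

    -- In degrees ≤ m the condition θ(x + y) ∈ (x + y)^m S only leaves the constant term of the cofactor.
    lowDegree-multipleOfζ : ∀ {f g} → InD p a b m (f , g) → Σ ℕ λ u → ∀ i j → i + j ≤ m →
                            coeff f i j ≋ u * xHigh a P i j × coeff g i j ≋ u * xLow a P i j
    lowDegree-multipleOfζ {f} {g} θ∈D with InD-sum {f} {g} θ∈D
    ... | h , f+g≋Ph = u , coefficients
      where
      u : ℕ
      u = coeff h 0 0
      f+g≋uP : ∀ i j → i + j ≤ m → coeff f i j + coeff g i j ≋ u * P i j
      f+g≋uP i j i+j≤m = ≋-trans (f+g≋Ph i j)
        (≡⇒≋ (trans (mulC-powC-xyC-lowDeg m (coeff h) i j i+j≤m) (*-comm (P i j) u)))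
      coefficients : ∀ i j → i + j ≤ m → coeff f i j ≋ u * xHigh a P i j × coeff g i j ≋ u * xLow a P i j
      coefficients i j i+j≤m with a ≤? i
      ... | no a≰i =
                     ≋-trans f≋0 (≡⇒≋ (sym (trans (cong (u *_) (xHigh-below a P i j (≰⇒> a≰i))) (*-zeroʳ u)))) ,
                     ≋-trans (≋-sym (+-identityˡ-≋ f≋0))
                       (≋-trans (f+g≋uP i j i+j≤m) (≡⇒≋ (cong (u *_) (sym (xLow-below a P i j (≰⇒> a≰i))))))
        where
        f≋0 : coeff f i j ≋ 0
        f≋0 = InD-xPart-below {f} {g} θ∈D i j (≰⇒> a≰i)
      ... | yes a≤i with b ≤? j
      ...   | yes b≤j = ⊥-elim (¬[a≤i∧b≤j∧i+j≤m] a≤i b≤j i+j≤m)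
      ...   | no  b≰j = ≋-trans (≋-sym (+-identityʳ-≋ g≋0))
                          (≋-trans (f+g≋uP i j i+j≤m) (≡⇒≋ (cong (u *_) (sym (xHigh-above a P i j a≤i))))) ,
                        ≋-trans g≋0 (≡⇒≋ (sym (trans (cong (u *_) (xLow-above a P i j a≤i)) (*-zeroʳ u))))
        where
        g≋0 : coeff g i j ≋ 0
        g≋0 = InD-yPart-below {f} {g} θ∈D i j (≰⇒> b≰j)

    lowDegree-notBasis : ∀ {d θ₁ θ₂} → d ≤ m → HomogDer d θ₁ → HomogDer d θ₂ → ¬ IsBasis p a b m θ₁ θ₂
    lowDegree-notBasis {d} {F₁ , G₁} {F₂ , G₂} d≤m (F₁-hom , G₁-hom) (F₂-hom , G₂-hom)
                       basis@(θ₁∈D , θ₂∈D , _) =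
      basis-first≉0 {a} {b} {m} {F₁} {G₁} {F₂ , G₂} basis
        (vanishes F₁-hom (λ i j → proj₁ ∘ mult₁ i j)) (vanishes G₁-hom (λ i j → proj₂ ∘ mult₁ i j))
      where
      u₁ u₂ : ℕ
      u₁ = proj₁ (lowDegree-multipleOfζ {F₁} {G₁} θ₁∈D)
      u₂ = proj₁ (lowDegree-multipleOfζ {F₂} {G₂} θ₂∈D)
      mult₁ : ∀ i j → i + j ≤ m → coeff F₁ i j ≋ u₁ * xHigh a P i j × coeff G₁ i j ≋ u₁ * xLow a P i j
      mult₁ = proj₂ (lowDegree-multipleOfζ {F₁} {G₁} θ₁∈D)
      mult₂ : ∀ i j → i + j ≤ m → coeff F₂ i j ≋ u₂ * xHigh a P i j × coeff G₂ i j ≋ u₂ * xLow a P i j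
      mult₂ = proj₂ (lowDegree-multipleOfζ {F₂} {G₂} θ₂∈D)

      dependent : ∀ {x₁ x₂ z : Coeffs} → HomogC p d x₁ → HomogC p d x₂ →
        (∀ i j → i + j ≤ m → x₁ i j ≋ u₁ * z i j) → (∀ i j → i + j ≤ m → x₂ i j ≋ u₂ * z i j) →
        ∀ i j → u₂ * x₁ i j + neg u₁ * x₂ i j ≋ 0
      dependent {z = z} x₁-hom x₂-hom x₁≋u₁z x₂≋u₂z i j with i + j ≟ d
      ... | yes i+j≡d = multiples-dependent u₁ u₂ (z i j) (x₁≋u₁z i j i+j≤m) (x₂≋u₂z i j i+j≤m)
        where
        i+j≤m : i + j ≤ m
        i+j≤m = subst (_≤ m) (sym i+j≡d) d≤m
      ... | no  i+j≢d = multiples-dependent u₁ u₂ 0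
        (≋-trans (ModEq⇒≋ (x₁-hom i j i+j≢d)) (≡⇒≋ (sym (*-zeroʳ u₁))))
        (≋-trans (ModEq⇒≋ (x₂-hom i j i+j≢d)) (≡⇒≋ (sym (*-zeroʳ u₂))))

      u₁≋0 : u₁ ≋ 0
      u₁≋0 = ≋-trans (≋-sym (+-identityʳ-≋ (proj₂ u₂,neg-u₁≋0))) (+-inverseʳ-≋ u₁)
        where
        u₂,neg-u₁≋0 : u₂ ≋ 0 × neg u₁ ≋ 0
        u₂,neg-u₁≋0 = independent-const {a} {b} {m} {F₁} {G₁} {F₂} {G₂} basis u₂ (neg u₁)
          (dependent F₁-hom F₂-hom (λ i j → proj₁ ∘ mult₁ i j) (λ i j → proj₁ ∘ mult₂ i j))
          (dependent G₁-hom G₂-hom (λ i j → proj₂ ∘ mult₁ i j) (λ i j → proj₂ ∘ mult₂ i j))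

      vanishes : ∀ {x z : Coeffs} → HomogC p d x → (∀ i j → i + j ≤ m → x i j ≋ u₁ * z i j) → x ≈ zeroC
      vanishes {z = z} x-hom x≋u₁z i j with i + j ≟ d
      ... | yes i+j≡d = ≋-trans (x≋u₁z i j (subst (_≤ m) (sym i+j≡d) d≤m)) (*-zeroˡ-≋ (z i j) u₁≋0)
      ... | no  i+j≢d = ModEq⇒≋ (x-hom i j i+j≢d)

    highDegree-notGenerating : ∀ {d θ₁ θ₂} → m < d → HomogDer d θ₁ → HomogDer d θ₂ →
                               IsBasis p a b m θ₁ θ₂ → ¬ p ∣ binomPred m a
    highDegree-notGenerating {d} {F₁ , G₁} {F₂ , G₂} m<d (F₁-hom , G₁-hom) (F₂-hom , G₂-hom)
                             (_ , _ , generates , _) p∣binom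
      with generates ζ (ζ-InD p∣binom) | ζ-unitCoeff
    ... | A , B , ζx≈ , _ | inj₁ ζx[m,0]≡1 = 1≉0 (begin
      1                                                               ≡⟨ ζx[m,0]≡1 ⟨
      xHigh a P m 0                                                   ≈⟨ ModEq⇒≋ (ζx≈ m 0) ⟩
      mulC (coeff A) (coeff F₁) m 0 + mulC (coeff B) (coeff F₂) m 0
        ≈⟨ combination-belowDeg (coeff A) (coeff B) (coeff F₁) (coeff F₂) F₁-hom F₂-hom m 0
                                (subst (_< d) (sym (+-identityʳ m)) m<d) ⟩
      0                                                               ∎)
      where open ≋-Reasoning
    ... | A , B , _ , ζy≈ | inj₂ ζy[0,m]≡1 = 1≉0 (begin
      1                                                               ≡⟨ ζy[0,m]≡1 ⟨
      xLow a P 0 m                                                    ≈⟨ ModEq⇒≋ (ζy≈ 0 m) ⟩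
      mulC (coeff A) (coeff G₁) 0 m + mulC (coeff B) (coeff G₂) 0 m
        ≈⟨ combination-belowDeg (coeff A) (coeff B) (coeff G₁) (coeff G₂) G₁-hom G₂-hom 0 m m<d ⟩
      0                                                               ∎)
      where open ≋-Reasoning

    deltaZero⇒∤binom : DeltaZero p a b m → ¬ p ∣ binomPred m a
    deltaZero⇒∤binom (d , θ₁ , θ₂ , θ₁-hom , θ₂-hom , basis) with d ≤? m
    ... | yes d≤m = λ _ → lowDegree-notBasis {d} {θ₁} {θ₂} d≤m θ₁-hom θ₂-hom basis
    ... | no  d≰m = highDegree-notGenerating {d} {θ₁} {θ₂} (≰⇒> d≰m) θ₁-hom θ₂-hom basis

  -- A basis with both exponents m + 1

  module Basis (k l m : ℕ) (k+l≡m : k + l ≡ m) (κ : ℕ) (κc≋1 : κ * (m C k) ≋ 1) where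

    open Membership (suc k) (suc l) m

    P M : Coeffs
    P = powC xyC m
    M = monomial (suc k) (suc l)

    c : ℕ
    c = m C k

    c-cancel : ∀ {x} → c * x ≋ 0 → x ≋ 0
    c-cancel {x} cx≋0 = begin
      x            ≡⟨ *-identityˡ x ⟨
      1 * x        ≈⟨ *-cong-≋ κc≋1 (≋-refl {x}) ⟨
      κ * c * x    ≡⟨ *-assoc κ c x ⟩
      κ * (c * x)  ≈⟨ *-zeroʳ-≋ κ cx≋0 ⟩
      0            ∎
      where open ≋-Reasoning

    xP-homogeneous : Homogeneous (suc m) (mulX P)
    xP-homogeneous = mulX-homogeneous (powC-xyC-homogeneous m)

    yP-homogeneous : Homogeneous (suc m) (mulY P)
    yP-homogeneous = mulY-homogeneous (powC-xyC-homogeneous m)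

    θ₁ θ₂ : Der p
    θ₁ = split (suc k) (mulX P) xP-homogeneous
    θ₂ = split (suc k) (mulY P) yP-homogeneous

    f₁ g₁ f₂ g₂ : Coeffs
    f₁ = xHigh (suc k) (mulX P)
    g₁ = xLow (suc k) (mulX P)
    f₂ = xHigh (suc k) (mulY P)
    g₂ = xLow (suc k) (mulY P)

    xLow-belowY : ∀ {w} → Homogeneous (suc m) w → ∀ i j → j < suc l → xLow (suc k) w i j ≡ 0
    xLow-belowY {w} w-hom i j j≤l with suc k ≤? i
    ... | yes k<i = xLow-above (suc k) w i j k<i
    ... | no  k≮i = trans (xLow-below (suc k) w i j (≰⇒> k≮i)) (w-hom i j λ i+j≡1+m →
      <⇒≢ (s≤s (subst (i + j ≤_) k+l≡m (+-mono-≤ (≤-pred (≰⇒> k≮i)) (≤-pred j≤l)))) i+j≡1+m)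

    θ₁∈D : InD p (suc k) (suc l) m θ₁
    θ₁∈D = split-InD (suc k) (suc l) m (mulX P) xP-homogeneous
      (toPoly xC 2 (homogeneous⇒vanishesFrom xC-homogeneous))
      (λ i j → sym (trans (mulC-comm P xC i j) (mulC-xCˡ P i j)))
      (λ i j j≤l → ≡⇒≋ (xLow-belowY xP-homogeneous i j j≤l))

    θ₂∈D : InD p (suc k) (suc l) m θ₂
    θ₂∈D = split-InD (suc k) (suc l) m (mulY P) yP-homogeneous
      (toPoly yC 2 (homogeneous⇒vanishesFrom yC-homogeneous))
      (λ i j → sym (trans (mulC-comm P yC i j) (mulC-yCˡ P i j)))
      (λ i j j≤l → ≡⇒≋ (xLow-belowY yP-homogeneous i j j≤l))

    mulC-θ₁-sum : ∀ w → addC (mulC w f₁) (mulC w g₁) ≐ mulC P (mulX w)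
    mulC-θ₁-sum w i j = trans (mulC-xHigh+xLow (suc k) w (mulX P) i j)
      (trans (sym (mulC-mulX-move w P i j)) (mulC-comm (mulX w) P i j))

    mulC-θ₂-sum : ∀ w → addC (mulC w f₂) (mulC w g₂) ≐ mulC P (mulY w)
    mulC-θ₂-sum w i j = trans (mulC-xHigh+xLow (suc k) w (mulY P) i j)
      (trans (sym (mulC-mulY-move w P i j)) (mulC-comm (mulY w) P i j))

    cM-off : ∀ i j → ¬ (i ≡ suc k × j ≡ suc l) → c * M i j ≡ 0
    cM-off i j ≢ = trans (cong (c *_) (monomial-offDiag (suc k) (suc l) i j ≢)) (*-zeroʳ c)

    -- The x-degree k + 1 part of x y (x + y)^m is c x^(k+1) y^(l+1).
    yf₁≐xf₂+cM : mulY f₁ ≐ addC (mulX f₂) (scale c M)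
    yf₁≐xf₂+cM zero    zero    = sym (cM-off 0 0 λ ())
    yf₁≐xf₂+cM (suc i) zero    = sym (cong₂ _+_ (xHigh-≡0 (suc k) (mulY P) i 0 refl) (cM-off (suc i) 0 λ ()))
    yf₁≐xf₂+cM zero    (suc j) = sym (cM-off 0 (suc j) λ ())
    yf₁≐xf₂+cM (suc i) (suc j) with <-cmp i k
    ... | tri< i<k _ _ = trans (xHigh-below k P i j i<k) (sym (cong₂ _+_
          (xHigh-below (suc k) (mulY P) i (suc j) (m<n⇒m<1+n i<k))
          (cM-off (suc i) (suc j) λ (1+i≡1+k , _) → <⇒≢ i<k (suc-injective 1+i≡1+k))))
    ... | tri> _ _ k<i = trans (xHigh-above k P i j (<⇒≤ k<i)) (sym (trans (cong₂ _+_
          (xHigh-above (suc k) (mulY P) i (suc j) k<i)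
          (cM-off (suc i) (suc j) λ (1+i≡1+k , _) → <⇒≢ k<i (sym (suc-injective 1+i≡1+k))))
          (+-identityʳ _)))
    ... | tri≈ _ refl _ with j ≟ l
    ...   | yes refl = trans (xHigh-above k P k l ≤-refl) (trans (powC-xyC-binomial m k l k+l≡m)
            (sym (trans (cong (_+ c * M (suc k) (suc l)) (xHigh-below (suc k) (mulY P) k (suc l) ≤-refl))
                        (trans (cong (c *_) (monomial-diag (suc k) (suc l))) (*-identityʳ c)))))
    ...   | no  j≢l = trans (xHigh-above k P k j ≤-refl) (trans
            (powC-xyC-homogeneous m k j λ k+j≡m → j≢l (+-cancelˡ-≡ k j l (trans k+j≡m (sym k+l≡m))))
            (sym (cong₂ _+_ (xHigh-below (suc k) (mulY P) k (suc j) ≤-refl)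
                            (cM-off (suc k) (suc j) λ (_ , 1+j≡1+l) → j≢l (suc-injective 1+j≡1+l)))))

    xg₂≐yg₁+cM : mulX g₂ ≐ addC (mulY g₁) (scale c M)
    xg₂≐yg₁+cM i j = +-cancelˡ-≡ (mulX f₂ i j) _ _ (begin
      mulX f₂ i j + mulX g₂ i j                ≡⟨ mulX-addC f₂ g₂ i j ⟨
      mulX (addC f₂ g₂) i j                    ≡⟨ mulX-cong (xHigh+xLow (suc k) (mulY P)) i j ⟩
      mulX (mulY P) i j                        ≡⟨ mulX-mulY-comm P i j ⟩
      mulY (mulX P) i j                        ≡⟨ mulY-cong (xHigh+xLow (suc k) (mulX P)) i j ⟨
      mulY (addC f₁ g₁) i j                    ≡⟨ mulY-addC f₁ g₁ i j ⟩
      mulY f₁ i j + mulY g₁ i j                ≡⟨ cong (_+ mulY g₁ i j) (yf₁≐xf₂+cM i j) ⟩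
      (mulX f₂ i j + c * M i j) + mulY g₁ i j  ≡⟨ +-exchangeʳ (mulX f₂ i j) (c * M i j) (mulY g₁ i j) ⟩
      (mulX f₂ i j + mulY g₁ i j) + c * M i j  ≡⟨ +-assoc (mulX f₂ i j) (mulY g₁ i j) (c * M i j) ⟩
      mulX f₂ i j + (mulY g₁ i j + c * M i j)  ∎)
      where open ≡-Reasoning

    syzygy-x : ∀ s → mulC (mulY s) f₁ ≐ addC (mulC (mulX s) f₂) (scale c (mulMonomial (suc k) (suc l) s))
    syzygy-x s i j = begin
      mulC (mulY s) f₁ i j                             ≡⟨ mulC-mulY-move s f₁ i j ⟩
      mulC s (mulY f₁) i j                             ≡⟨ mulC-congʳ s yf₁≐xf₂+cM i j ⟩
      mulC s (addC (mulX f₂) (scale c M)) i j          ≡⟨ mulC-addCʳ s (mulX f₂) (scale c M) i j ⟩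
      mulC s (mulX f₂) i j + mulC s (scale c M) i j
        ≡⟨ cong₂ _+_ (sym (mulC-mulX-move s f₂ i j)) (mulC-scaleʳ c s M i j) ⟩
      mulC (mulX s) f₂ i j + c * mulC s M i j
        ≡⟨ cong (λ z → mulC (mulX s) f₂ i j + c * z) (mulC-monomialʳ (suc k) (suc l) s i j) ⟩
      mulC (mulX s) f₂ i j + c * mulMonomial (suc k) (suc l) s i j ∎
      where open ≡-Reasoning

    syzygy-y : ∀ s → mulC (mulX s) g₂ ≐ addC (mulC (mulY s) g₁) (scale c (mulMonomial (suc k) (suc l) s))
    syzygy-y s i j = begin
      mulC (mulX s) g₂ i j                             ≡⟨ mulC-mulX-move s g₂ i j ⟩
      mulC s (mulX g₂) i j                             ≡⟨ mulC-congʳ s xg₂≐yg₁+cM i j ⟩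
      mulC s (addC (mulY g₁) (scale c M)) i j          ≡⟨ mulC-addCʳ s (mulY g₁) (scale c M) i j ⟩
      mulC s (mulY g₁) i j + mulC s (scale c M) i j
        ≡⟨ cong₂ _+_ (sym (mulC-mulY-move s g₁ i j)) (mulC-scaleʳ c s M i j) ⟩
      mulC (mulY s) g₁ i j + c * mulC s M i j
        ≡⟨ cong (λ z → mulC (mulY s) g₁ i j + c * z) (mulC-monomialʳ (suc k) (suc l) s i j) ⟩
      mulC (mulY s) g₁ i j + c * mulMonomial (suc k) (suc l) s i j ∎
      where open ≡-Reasoning

    -- The two components of t s (y θ₁ − x θ₂) = t c s x^(k+1) y^(l+1) (∂x − ∂y).
    syzygy-x-≋ : ∀ t s i j → mulC (scale t (mulY s)) f₁ i j + mulC (scale (neg t) (mulX s)) f₂ i j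
                             ≋ t * c * mulMonomial (suc k) (suc l) s i j
    syzygy-x-≋ t s i j = begin
      mulC (scale t (mulY s)) f₁ i j + mulC (scale (neg t) (mulX s)) f₂ i j
        ≡⟨ cong₂ _+_ (trans (mulC-scaleˡ t (mulY s) f₁ i j) (cong (t *_) (syzygy-x s i j)))
                     (mulC-scaleˡ (neg t) (mulX s) f₂ i j) ⟩
      t * (X + c * S) + pred p * t * X   ≡⟨ rearrange (pred p) t X c S ⟩
      t * c * S + (t * X + neg (t * X))  ≈⟨ +-identityʳ-≋ (+-inverseʳ-≋ (t * X)) ⟩
      t * c * S                          ∎
      where
      open ≋-Reasoning
      X S : ℕ
      X = mulC (mulX s) f₂ i j
      S = mulMonomial (suc k) (suc l) s i j
      rearrange : ∀ q t X c S → t * (X + c * S) + q * t * X ≡ t * c * S + (t * X + q * (t * X))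
      rearrange = solve-∀

    syzygy-y-≋ : ∀ t s i j → mulC (scale t (mulY s)) g₁ i j + mulC (scale (neg t) (mulX s)) g₂ i j
                             ≋ neg (t * c * mulMonomial (suc k) (suc l) s i j)
    syzygy-y-≋ t s i j = begin
      mulC (scale t (mulY s)) g₁ i j + mulC (scale (neg t) (mulX s)) g₂ i j
        ≡⟨ cong₂ _+_ (mulC-scaleˡ t (mulY s) g₁ i j)
                     (trans (mulC-scaleˡ (neg t) (mulX s) g₂ i j) (cong (neg t *_) (syzygy-y s i j))) ⟩
      t * Y + pred p * t * (Y + c * S)              ≡⟨ rearrange (pred p) t Y c S ⟩
      (t * Y + neg (t * Y)) + neg (t * c * S)       ≈⟨ +-identityˡ-≋ (+-inverseʳ-≋ (t * Y)) ⟩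
      neg (t * c * S)                               ∎
      where
      open ≋-Reasoning
      Y S : ℕ
      Y = mulC (mulY s) g₁ i j
      S = mulMonomial (suc k) (suc l) s i j
      rearrange : ∀ q t Y c S → t * Y + q * t * (Y + c * S) ≡ (t * Y + q * (t * Y)) + q * (t * c * S)
      rearrange = solve-∀

    mulC-P-combination : ∀ a b → mulC P (addC (mulX a) (mulY b)) ≐
                         addC (addC (mulC a f₁) (mulC b f₂)) (addC (mulC a g₁) (mulC b g₂))
    mulC-P-combination a b i j = begin
      mulC P (addC (mulX a) (mulY b)) i j
        ≡⟨ mulC-addCʳ P (mulX a) (mulY b) i j ⟩
      mulC P (mulX a) i j + mulC P (mulY b) i j
        ≡⟨ cong₂ _+_ (sym (mulC-θ₁-sum a i j)) (sym (mulC-θ₂-sum b i j)) ⟩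
      (mulC a f₁ i j + mulC a g₁ i j) + (mulC b f₂ i j + mulC b g₂ i j)
        ≡⟨ +-interchange (mulC a f₁ i j) (mulC a g₁ i j) (mulC b f₂ i j) (mulC b g₂ i j) ⟩
      (mulC a f₁ i j + mulC b f₂ i j) + (mulC a g₁ i j + mulC b g₂ i j) ∎
      where open ≡-Reasoning

    -- If a θ₁ + b θ₂ = 0 then x a + y b = 0, so (a, b) = (y a′, −x a′) and the relation
    -- becomes c a′ x^(k+1) y^(l+1) (∂x − ∂y) = 0.
    independent : ∀ a b → addC (mulC a f₁) (mulC b f₂) ≈ zeroC → addC (mulC a g₁) (mulC b g₂) ≈ zeroC →
                  a ≈ zeroC × b ≈ zeroC
    independent a b ∂x≈0 ∂y≈0 = a≈0 , b≈0
      where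
      xa+yb≈0 : addC (mulX a) (mulY b) ≈ zeroC
      xa+yb≈0 = mulC-powC-xyC-cancel m (addC (mulX a) (mulY b)) λ i j →
        ≋-trans (≡⇒≋ (mulC-P-combination a b i j)) (+-cong-≋ (∂x≈0 i j) (∂y≈0 i j))

      a′ : Coeffs
      a′ i j = a i (suc j)

      a≈ya′ : a ≈ scale 1 (mulY a′)
      a≈ya′ i zero    = ≋-trans (≡⇒≋ (sym (+-identityʳ (a i 0)))) (xa+yb≈0 (suc i) 0)
      a≈ya′ i (suc j) = ≡⇒≋ (sym (*-identityˡ (a′ i j)))

      b≈-xa′ : b ≈ scale (neg 1) (mulX a′)
      b≈-xa′ zero    j = ≋-trans (xa+yb≈0 0 (suc j)) (≡⇒≋ (sym (*-zeroʳ (neg 1))))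
      b≈-xa′ (suc i) j = ≋-trans (+≋0⇒≋neg (xa+yb≈0 (suc i) (suc j)))
                                 (≡⇒≋ (cong (_* a′ i j) (sym (*-identityʳ (pred p)))))

      a′≈0 : a′ ≈ zeroC
      a′≈0 i j = c-cancel (begin
        c * a′ i j
          ≡⟨ cong (c *_) (mulMonomial-+ (suc k) (suc l) a′ i j) ⟨
        c * mulMonomial (suc k) (suc l) a′ i′ j′
          ≡⟨ cong (_* mulMonomial (suc k) (suc l) a′ i′ j′) (+-identityʳ c) ⟨
        1 * c * mulMonomial (suc k) (suc l) a′ i′ j′
          ≈⟨ syzygy-x-≋ 1 a′ i′ j′ ⟨
        mulC (scale 1 (mulY a′)) f₁ i′ j′ + mulC (scale (neg 1) (mulX a′)) f₂ i′ j′
          ≈⟨ +-cong-≋ (mulC-cong-≋ a≈ya′ (≈-refl {f₁}) i′ j′) (mulC-cong-≋ b≈-xa′ (≈-refl {f₂}) i′ j′) ⟨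
        mulC a f₁ i′ j′ + mulC b f₂ i′ j′
          ≈⟨ ∂x≈0 i′ j′ ⟩
        0 ∎)
        where
        open ≋-Reasoning
        i′ j′ : ℕ
        i′ = suc k + i
        j′ = suc l + j

      a≈0 : a ≈ zeroC
      a≈0 i zero    = a≈ya′ i zero
      a≈0 i (suc j) = ≋-trans (a≈ya′ i (suc j)) (*-zeroʳ-≋ 1 (a′≈0 i j))

      b≈0 : b ≈ zeroC
      b≈0 zero    j = ≋-trans (b≈-xa′ zero j) (≡⇒≋ (*-zeroʳ (neg 1)))
      b≈0 (suc i) j = ≋-trans (b≈-xa′ (suc i) j) (*-zeroʳ-≋ (neg 1) (a′≈0 i j))

    module Generation {f g : Poly p} (θ∈D : InD p (suc k) (suc l) m (f , g)) where

      h : Poly p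
      h = proj₁ (InD-sum {f} {g} θ∈D)

      f+g≋Ph : ∀ i j → coeff f i j + coeff g i j ≋ mulC P (coeff h) i j
      f+g≋Ph = proj₂ (InD-sum {f} {g} θ∈D)

      H₀ : ℕ
      H₀ = coeff h 0 0

      H₁ H₂ : Coeffs
      H₁ = coeff h ∘ suc
      H₂ = xLow 1 (λ i j → coeff h i (suc j))

      h-decomposition : coeff h ≐ addC (scale H₀ oneC) (addC (mulX H₁) (mulY H₂))
      h-decomposition zero    zero    = sym (trans (+-identityʳ _) (*-identityʳ H₀))
      h-decomposition zero    (suc j) = sym (cong (_+ coeff h 0 (suc j)) (*-zeroʳ H₀))
      h-decomposition (suc i) zero    = sym (trans (cong (_+ (H₁ i 0 + 0)) (*-zeroʳ H₀)) (+-identityʳ _))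
      h-decomposition (suc i) (suc j) = sym (trans (cong (_+ (H₁ i (suc j) + 0)) (*-zeroʳ H₀)) (+-identityʳ _))

      H₀≋0 : H₀ ≋ 0
      H₀≋0 = c-cancel (begin
        c * H₀                     ≡⟨ cong (_* H₀) (powC-xyC-binomial m k l k+l≡m) ⟨
        P k l * H₀                 ≡⟨ mulC-powC-xyC-lowDeg m (coeff h) k l (≤-reflexive k+l≡m) ⟨
        mulC P (coeff h) k l       ≈⟨ f+g≋Ph k l ⟨
        coeff f k l + coeff g k l  ≈⟨ +-cong-≋ (InD-xPart-below {f} {g} θ∈D k l ≤-refl)
                                               (InD-yPart-below {f} {g} θ∈D k l ≤-refl) ⟩
        0                          ∎)
        where open ≋-Reasoning

      R Rg : Coeffs
      R  = addC (mulC H₁ f₁) (mulC H₂ f₂)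
      Rg = addC (mulC H₁ g₁) (mulC H₂ g₂)

      f+g≋R+Rg : ∀ i j → coeff f i j + coeff g i j ≋ R i j + Rg i j
      f+g≋R+Rg i j = begin
        coeff f i j + coeff g i j
          ≈⟨ f+g≋Ph i j ⟩
        mulC P (coeff h) i j
          ≡⟨ trans (mulC-congʳ P h-decomposition i j)
                   (mulC-addCʳ P (scale H₀ oneC) (addC (mulX H₁) (mulY H₂)) i j) ⟩
        mulC P (scale H₀ oneC) i j + mulC P (addC (mulX H₁) (mulY H₂)) i j
          ≈⟨ +-identityˡ-≋ (≋-trans (≡⇒≋ (mulC-scaleʳ H₀ P oneC i j)) (*-zeroˡ-≋ _ H₀≋0)) ⟩
        mulC P (addC (mulX H₁) (mulY H₂)) i j
          ≡⟨ mulC-P-combination H₁ H₂ i j ⟩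
        R i j + Rg i j ∎
        where open ≋-Reasoning

      R-belowX : ∀ i j → i < suc k → R i j ≡ 0
      R-belowX i j i≤k = cong₂ _+_
        (mulC-belowX (suc k) H₁ f₁ i j (xHigh-below (suc k) (mulX P)) i≤k)
        (mulC-belowX (suc k) H₂ f₂ i j (xHigh-below (suc k) (mulY P)) i≤k)

      Rg-belowY : ∀ i j → j < suc l → Rg i j ≡ 0
      Rg-belowY i j j≤l = cong₂ _+_
        (mulC-belowY (suc l) H₁ g₁ i j (xLow-belowY xP-homogeneous) j≤l)
        (mulC-belowY (suc l) H₂ g₂ i j (xLow-belowY yP-homogeneous) j≤l)

      s S : Coeffs
      s i j = coeff f (suc k + i) (suc l + j) + neg (R (suc k + i) (suc l + j))
      S = mulMonomial (suc k) (suc l) s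

      f≋R+S : ∀ i j → coeff f i j ≋ R i j + S i j
      f≋R+S i j with suc k ≤? i | suc l ≤? j
      ... | no k≮i | _ = ≋-trans (InD-xPart-below {f} {g} θ∈D i j (≰⇒> k≮i))
        (≡⇒≋ (sym (cong₂ _+_ (R-belowX i j (≰⇒> k≮i))
                             (mulMonomial-belowX (suc k) (suc l) s i j (≰⇒> k≮i)))))
      ... | yes _ | no l≮j = begin
        coeff f i j                ≈⟨ +-identityʳ-≋ (InD-yPart-below {f} {g} θ∈D i j (≰⇒> l≮j)) ⟨
        coeff f i j + coeff g i j  ≈⟨ f+g≋R+Rg i j ⟩
        R i j + Rg i j             ≡⟨ cong (R i j +_) (trans (Rg-belowY i j (≰⇒> l≮j))
                                         (sym (mulMonomial-belowY (suc k) (suc l) s i j (≰⇒> l≮j)))) ⟩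
        R i j + S i j              ∎
        where open ≋-Reasoning
      ... | yes k<i | yes l<j = begin
        coeff f i j                            ≈⟨ +-identityʳ-≋ (+-inverseʳ-≋ (R i j)) ⟨
        coeff f i j + (R i j + neg (R i j))    ≡⟨ +-exchangeˡ (coeff f i j) (R i j) (neg (R i j)) ⟩
        R i j + (coeff f i j + neg (R i j))    ≡⟨ cong (R i j +_) S≡f-R ⟨
        R i j + S i j                          ∎
        where
        open ≋-Reasoning
        S≡f-R : S i j ≡ coeff f i j + neg (R i j)
        S≡f-R = trans (mulMonomial-above (suc k) (suc l) s i j k<i l<j)
          (cong₂ (λ i′ j′ → coeff f i′ j′ + neg (R i′ j′)) (m+[n∸m]≡n k<i) (m+[n∸m]≡n l<j))

      g≋Rg-S : ∀ i j → coeff g i j ≋ Rg i j + neg (S i j)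
      g≋Rg-S i j = begin
        coeff g i j                          ≈⟨ +-identityʳ-≋ (+-inverseʳ-≋ (S i j)) ⟨
        coeff g i j + (S i j + neg (S i j))  ≡⟨ +-exchangeˡ (coeff g i j) (S i j) (neg (S i j)) ⟩
        S i j + (coeff g i j + neg (S i j))  ≡⟨ +-assoc (S i j) (coeff g i j) (neg (S i j)) ⟨
        (S i j + coeff g i j) + neg (S i j)  ≈⟨ +-cong-≋ S+g≋Rg ≋-refl ⟩
        Rg i j + neg (S i j)                 ∎
        where
        open ≋-Reasoning
        S+g≋Rg : S i j + coeff g i j ≋ Rg i j
        S+g≋Rg = +-cancelʳ-≋ {c = R i j} (begin
          (S i j + coeff g i j) + R i j  ≡⟨ +-comm (S i j + coeff g i j) (R i j) ⟩
          R i j + (S i j + coeff g i j)  ≡⟨ +-assoc (R i j) (S i j) (coeff g i j) ⟨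
          (R i j + S i j) + coeff g i j  ≈⟨ +-cong-≋ (f≋R+S i j) ≋-refl ⟨
          coeff f i j + coeff g i j      ≈⟨ f+g≋R+Rg i j ⟩
          R i j + Rg i j                 ≡⟨ +-comm (R i j) (Rg i j) ⟩
          Rg i j + R i j                 ∎)

      Bₛ : ℕ
      Bₛ = bound f + (bound h + suc (suc m))

      H₁-vanishes : VanishesFrom (bound h) H₁
      H₁-vanishes i j B≤i+j = poly-vanishesFrom h (suc i) j (≤-trans B≤i+j (n≤1+n _))

      H₂-vanishes : VanishesFrom (bound h) H₂
      H₂-vanishes zero    j B≤j = poly-vanishesFrom h 0 (suc j) (≤-trans B≤j (n≤1+n _))
      H₂-vanishes (suc i) j _   = ≋-refl

      s-vanishes : VanishesFrom Bₛ s
      s-vanishes i j Bₛ≤i+j = +-cong-≋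
        (poly-vanishesFrom f (suc k + i) (suc l + j) (≤-trans (≤-trans (m≤m+n (bound f) _) Bₛ≤i+j) shifted))
        (*-zeroʳ-≋ (pred p)
          (R-vanishes (suc k + i) (suc l + j) (≤-trans (≤-trans (m≤n+m _ (bound f)) Bₛ≤i+j) shifted)))
        where
        shifted : i + j ≤ (suc k + i) + (suc l + j)
        shifted = +-mono-≤ (m≤n+m i (suc k)) (m≤n+m j (suc l))
        R-vanishes : VanishesFrom (bound h + suc (suc m)) R
        R-vanishes = vanishesFrom-addC
          (vanishesFrom-mulC H₁-vanishes (homogeneous⇒vanishesFrom (xHigh-homogeneous (suc k) xP-homogeneous)))
          (vanishesFrom-mulC H₂-vanishes (homogeneous⇒vanishesFrom (xHigh-homogeneous (suc k) yP-homogeneous)))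

      Aᶜ Bᶜ : Coeffs
      Aᶜ = addC H₁ (scale κ (mulY s))
      Bᶜ = addC H₂ (scale (neg κ) (mulX s))

      A B : Poly p
      A = toPoly Aᶜ (suc (bound h + Bₛ)) (vanishesFrom-addC
        (vanishesFrom-mono (≤-trans (m≤m+n (bound h) Bₛ) (n≤1+n _)) H₁-vanishes)
        (vanishesFrom-scale κ (vanishesFrom-mono (s≤s (m≤n+m Bₛ (bound h))) (vanishesFrom-mulY s-vanishes))))
      B = toPoly Bᶜ (suc (bound h + Bₛ)) (vanishesFrom-addC
        (vanishesFrom-mono (≤-trans (m≤m+n (bound h) Bₛ) (n≤1+n _)) H₂-vanishes)
        (vanishesFrom-scale (neg κ) (vanishesFrom-mono (s≤s (m≤n+m Bₛ (bound h))) (vanishesFrom-mulX s-vanishes))))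

      κcS≋S : ∀ i j → κ * c * S i j ≋ S i j
      κcS≋S i j = ≋-trans (*-cong-≋ κc≋1 (≋-refl {S i j})) (≡⇒≋ (*-identityˡ (S i j)))

      ∂x-generated : ∀ i j → coeff f i j ≋ addC (mulC Aᶜ f₁) (mulC Bᶜ f₂) i j
      ∂x-generated i j = begin
        coeff f i j
          ≈⟨ f≋R+S i j ⟩
        R i j + S i j
          ≈⟨ +-cong-≋ (≋-refl {R i j}) (≋-trans (≋-sym (κcS≋S i j)) (≋-sym (syzygy-x-≋ κ s i j))) ⟩
        R i j + (mulC (scale κ (mulY s)) f₁ i j + mulC (scale (neg κ) (mulX s)) f₂ i j)
          ≡⟨ mulC-addCˡ-interchange H₁ H₂ (scale κ (mulY s)) (scale (neg κ) (mulX s)) f₁ f₂ i j ⟨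
        addC (mulC Aᶜ f₁) (mulC Bᶜ f₂) i j ∎
        where open ≋-Reasoning

      ∂y-generated : ∀ i j → coeff g i j ≋ addC (mulC Aᶜ g₁) (mulC Bᶜ g₂) i j
      ∂y-generated i j = begin
        coeff g i j
          ≈⟨ g≋Rg-S i j ⟩
        Rg i j + neg (S i j)
          ≈⟨ +-cong-≋ (≋-refl {Rg i j}) (≋-trans (*-cong-≋ (≋-refl {pred p}) (≋-sym (κcS≋S i j)))
                                                  (≋-sym (syzygy-y-≋ κ s i j))) ⟩
        Rg i j + (mulC (scale κ (mulY s)) g₁ i j + mulC (scale (neg κ) (mulX s)) g₂ i j)
          ≡⟨ mulC-addCˡ-interchange H₁ H₂ (scale κ (mulY s)) (scale (neg κ) (mulX s)) g₁ g₂ i j ⟨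
        addC (mulC Aᶜ g₁) (mulC Bᶜ g₂) i j ∎
        where open ≋-Reasoning

    deltaZero : DeltaZero p (suc k) (suc l) m
    deltaZero = suc m , θ₁ , θ₂ ,
      split-homogeneous (suc k) (mulX P) xP-homogeneous , split-homogeneous (suc k) (mulY P) yP-homogeneous ,
      θ₁∈D , θ₂∈D ,
      (λ { (f , g) θ∈D → let open Generation {f} {g} θ∈D in
           A , B , (λ i j → ≋⇒ModEq (∂x-generated i j)) , (λ i j → ≋⇒ModEq (∂y-generated i j)) }) ,
      λ A B ∂x≈0 ∂y≈0 →
        let (A≈0 , B≈0) = independent (coeff A) (coeff B)
                            (λ i j → ModEq⇒≋ (∂x≈0 i j)) (λ i j → ModEq⇒≋ (∂y≈0 i j))
        in (λ i j → ≋⇒ModEq (A≈0 i j)) , (λ i j → ≋⇒ModEq (B≈0 i j))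

  ∤binom⇒deltaZero : ∀ a b m → a + b ≡ 2 + m → ¬ p ∣ binomPred m a → DeltaZero p a b m
  ∤binom⇒deltaZero zero    b m _        p∤0 = contradiction (p ∣0) p∤0
  ∤binom⇒deltaZero (suc k) b m 1+k+b≡2+m p∤c with k ≤? m
  ... | no  k≰m = contradiction (subst (p ∣_) (sym (k>n⇒nCk≡0 (≰⇒> k≰m))) (p ∣0)) p∤c
  ... | yes k≤m = subst (λ b → DeltaZero p (suc k) b m) (sym b≡1+l)
                    (Basis.deltaZero k l m k+l≡m (proj₁ (inverse p∤c)) (proj₂ (inverse p∤c)))
    where
    l : ℕ
    l = m ∸ k
    k+l≡m : k + l ≡ m
    k+l≡m = m+[n∸m]≡n k≤m
    b≡1+l : b ≡ suc l
    b≡1+l = +-cancelˡ-≡ k b (suc l) (trans (suc-injective 1+k+b≡2+m) (sym (trans (+-suc k l) (cong suc k+l≡m))))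

corollary5p12 : (p : ℕ) → Prime p → (m : ℕ) → 0 < m →
    (μ₁ μ₂ : ℕ) → μ₁ + μ₂ ≡ m + 2 →
      ((¬ (p ∣ binomPred m μ₁)) → DeltaZero p μ₁ μ₂ m) ×
      (DeltaZero p μ₁ μ₂ m → ¬ (p ∣ binomPred m μ₁))
corollary5p12 p p-prime m _ μ₁ μ₂ μ₁+μ₂≡m+2 =
  ∤binom⇒deltaZero μ₁ μ₂ m μ₁+μ₂≡2+m , Obstruction.deltaZero⇒∤binom μ₁ μ₂ m μ₁+μ₂≡2+m
  where
  open PrimeField p p-prime
  μ₁+μ₂≡2+m : μ₁ + μ₂ ≡ 2 + m
  μ₁+μ₂≡2+m = trans μ₁+μ₂≡m+2 (+-comm m 2)
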